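{- Let $n\ge3$ and let $C_n$ be the cycle with vertex set $\{1,\ldots,n\}$ and edges $(1,2),\ldots,(n-1,n),(n,1)$. Then the entries of the doubly stochastic graph matrix $F=(f_{ij}/f)$ of $C_n$ are, for all $i,j\in\{1,\ldots,n\}$ and $t=\bigl|n-2|j-i|\bigr|$, $$\frac{f_{ij}}{f}=\begin{cases}\mathcal F_t/\mathcal L_n,& n \text{ odd},\\ \mathcal L_t/(5\mathcal F_n),& n\text{ even}.\end{cases}$$
   Context: $(\mathcal F_k)_{k\ge0}$ are the Fibonacci numbers ($\mathcal F_0=0$, $\mathcal F_1=1$, $\mathcal F_{k+2}=\mathcal F_{k+1}+\mathcal F_k$) and $(\mathcal L_k)_{k\ge0}$ the Lucas numbers ($\mathcal L_0=2$, $\mathcal L_1=1$, $\mathcal L_{k+2}=\mathcal L_{k+1}+\mathcal L_k$). A spanning rooted forest of a graph is a spanning acyclic subgraph in which exactly one vertex (the root) is marked in each tree. $f_{ij}$ is the number of spanning rooted forests in which $i$ and $j$ lie in the same tree and that tree is rooted at $i$; $f$ is the total number of spanning rooted forests; the doubly stochastic graph matrix is $F=(f_{ij})_{n\times n}/f$. -}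

module Defs where

open import Data.Nat using (ℕ; zero; suc; _+_; _≤_)
open import Data.Fin using (Fin; zero; suc; fromℕ; inject₁; toℕ; fromℕ<)
open import Data.Nat.DivMod using (m%n<n)
open import Data.Bool using (Bool; true)
open import Data.Vec using (Vec; lookup; tabulate; [])
open import Data.List using (List; length)
open import Data.List.Membership.Propositional using (_∈_)
open import Data.List.Relation.Unary.Unique.Propositional using (Unique)
open import Data.Product using (Σ; ∃; _×_; _,_)
open import Data.Sum using (_⊎_)
open import Function.Bundles using (_⇔_)
open import Function.Definitions using (Injective)
open import Relation.Binary.PropositionalEquality using (_≡_)
open import Relation.Binary.Construct.Closure.ReflexiveTransitive using (Star)

fib : ℕ → ℕ
fib zero = 0
fib (suc zero) = 1
fib (suc (suc k)) = fib (suc k) + fib k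

lucas : ℕ → ℕ
lucas zero = 2
lucas (suc zero) = 1
lucas (suc (suc k)) = lucas (suc k) + lucas k

-- Graphs on vertex set Fin n given by a list (vector) of m edges.
-- A spanning subgraph is a choice of edges S : Vec Bool m.

Graph : ℕ → ℕ → Set
Graph n m = Vec (Fin n × Fin n) m

module _ {n m : ℕ} (G : Graph n m) where

  Adj : Vec Bool m → Fin n → Fin n → Set
  Adj S u v = ∃ λ (e : Fin m) → lookup S e ≡ true ×
    ((lookup G e ≡ (u , v)) ⊎ (lookup G e ≡ (v , u)))

  Connected : Vec Bool m → Fin n → Fin n → Set
  Connected S = Star (Adj S)

  -- a cycle of S: k+1 ≥ 3 pairwise distinct vertices v₀ … v_k with
  -- v_{i} ~ v_{i+1} and v_k ~ v₀ (graphs considered here are simple)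
  HasCycle : Vec Bool m → Set
  HasCycle S = ∃ λ (k : ℕ) → 2 ≤ k × Σ (Fin (suc k) → Fin n) λ vs →
    Injective _≡_ _≡_ vs ×
    ((i : Fin k) → Adj S (vs (inject₁ i)) (vs (suc i))) ×
    Adj S (vs (fromℕ k)) (vs zero)

  Acyclic : Vec Bool m → Set
  Acyclic S = HasCycle S → Data.Empty.⊥
    where import Data.Empty

  RootedForest : Vec Bool m × Vec Bool n → Set
  RootedForest (S , R) = Acyclic S ×
    ((v : Fin n) → ∃ λ r → lookup R r ≡ true × Connected S v r) ×
    ((r r′ : Fin n) → lookup R r ≡ true → lookup R r′ ≡ true →
       Connected S r r′ → r ≡ r′)

  RootedForestIJ : Fin n → Fin n → Vec Bool m × Vec Bool n → Set
  RootedForestIJ i j F@(S , R) =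
    RootedForest F × Connected S i j × lookup R i ≡ true

-- The cycle C_n on Fin n: edge k joins k and k+1 (mod n), i.e. vertex
-- k here is vertex k+1 of the paper, edges (1,2),…,(n-1,n),(n,1).
cycleGraph : (n : ℕ) → Graph n n
cycleGraph zero = []
cycleGraph (suc m) =
  tabulate λ k → k , fromℕ< (m%n<n (suc (toℕ k)) (suc m))

Card : {A : Set} → (A → Set) → ℕ → Set
Card {A} P k = Σ (List A) λ xs →
  Unique xs × ((x : A) → (x ∈ xs) ⇔ P x) × length xs ≡ k

-- A spanning rooted forest of the cycle is a word of vertex labels (is v a root, is
-- the edge from v to v + 1 chosen). A two-state automaton (has the current tree met its
-- root yet?) reads the word once around the cycle. A forest brings it back to its
-- initial state for exactly one of the two states; the only other such runs are the two
-- on the word choosing every edge and no root. By the transfer-matrix method these runs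
-- are counted by the trace of a product of 2×2 matrices, one factor per vertex. A free
-- vertex contributes M = [[2,1],[1,1]] and M^k = [[F(2k+1), F(2k)], [F(2k), F(2k-1)]],
-- so f = tr(M^n) - 2 = L(2n) - 2. Requiring i to be a root and the clockwise arc from i
-- to j (or from j to i) to be chosen changes a few factors, and the two traces give
-- f_ij = F(2A) + F(2B) with A + B = n and B = |j - i|. Finally L(2n) - 2 is L(n)² for
-- odd n and 5 F(n)² for even n, while F(2A) + F(2B) is L(n) F(t) for odd n and
-- F(n) L(t) for even n, where t = |A - B| = |n - 2 |j - i||.

module Submission where

open import Defs
open import Data.Bool using (Bool; true; false; not; _∧_; _∨_; if_then_else_)
open import Data.Bool.Properties using (T-≡; ¬-not) renaming (_≟_ to _≟ᵇ_)
open import Data.Empty using (⊥; ⊥-elim)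
open import Data.Fin using (Fin; zero; suc; toℕ; fromℕ<; fromℕ; inject₁)
open import Data.Fin.Properties
  using (toℕ-fromℕ<; toℕ-injective; toℕ<n; toℕ-inject₁; toℕ-fromℕ; all?; ¬∀⟶∃¬)
open import Data.List using (List; []; _∷_; _++_; map; length; filterᵇ; cartesianProduct; cartesianProductWith)
open import Data.List.Properties using (map-++; map-∘; map-cong)
open import Data.List.Membership.Propositional using (_∈_)
open import Data.List.Membership.Propositional.Properties
  using (∈-filter⁺; ∈-filter⁻; ∈-cartesianProduct⁺; ∈-cartesianProductWith⁺)
open import Data.List.Relation.Unary.Any using (here; there)
open import Data.List.Relation.Unary.AllPairs using ([]; _∷_)
open import Data.List.Relation.Unary.All using ([]; _∷_)
open import Data.List.Relation.Unary.Unique.Propositional using (Unique)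
open import Data.List.Relation.Unary.Unique.Propositional.Properties
  using (filter⁺; cartesianProduct⁺; cartesianProductWith⁺)
open import Data.Nat
open import Data.Nat.DivMod using (_mod_; [m+kn]%n≡m%n; m%n<n; m<n⇒m%n≡m; m≤n⇒m%n≡m; n%n≡0)
open import Data.Nat.ListAction using (sum)
open import Data.Nat.ListAction.Properties using (sum-++)
open import Data.Nat.Properties
open import Algebra.Properties.CommutativeSemigroup +-commutativeSemigroup
  using () renaming (interchange to +-interchange)
open import Data.Nat.Tactic.RingSolver using (solve-∀)
open import Data.Product using (∃; ∃₂; _×_; _,_; proj₁; proj₂)
open import Data.Sum using (_⊎_; inj₁; inj₂; [_,_]′; swap)
open import Data.Unit using (⊤; tt)
open import Data.Vec using (Vec; []; _∷_; lookup)
open import Data.Vec.Properties using (lookup∘tabulate)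
open import Function using (_∘_; Equivalence)
open import Function.Bundles using (_⇔_; mk⇔)
open import Relation.Binary.Construct.Closure.ReflexiveTransitive using (Star; ε; _◅_; reverse)
open import Relation.Binary.Definitions using (DecidableEquality; tri<; tri≈; tri>)
open import Relation.Binary.PropositionalEquality
open import Relation.Nullary using (¬_; Dec; yes; no; does; contradiction)
open import Relation.Nullary.Decidable using (T?; dec-true; dec-false; _×-dec_; _⊎-dec_)
open ≡-Reasoning

-- Fibonacci and Lucas identities

double : ℕ → ℕ
double zero = 0
double (suc n) = suc (suc (double n))

double-+ : ∀ m n → double (m + n) ≡ double m + double n
double-+ zero n = refl
double-+ (suc m) n = cong (λ k → suc (suc k)) (double-+ m n)

double≡+ : ∀ n → double n ≡ n + n
double≡+ zero = refl
double≡+ (suc n) = cong suc (trans (cong suc (double≡+ n)) (sym (+-suc n n)))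

double≡2* : ∀ n → double n ≡ 2 * n
double≡2* n = trans (double≡+ n) (cong (n +_) (sym (+-identityʳ n)))

even⊎odd : ∀ t → (∃ λ u → t ≡ double u) ⊎ (∃ λ u → t ≡ suc (double u))
even⊎odd zero = inj₁ (0 , refl)
even⊎odd (suc t) with even⊎odd t
... | inj₁ (u , t≡) = inj₂ (u , cong suc t≡)
... | inj₂ (u , t≡) = inj₁ (suc u , cong suc t≡)

[r+double]%2≡r%2 : ∀ r u → (r + double u) % 2 ≡ r % 2
[r+double]%2≡r%2 r u = trans (cong (λ k → (r + k) % 2) (trans (double≡2* u) (*-comm 2 u)))
                           ([m+kn]%n≡m%n r u 2)

odd-part : ∀ c t → (double c + t) % 2 ≡ 1 → ∃ λ u → t ≡ suc (double u)
odd-part c t odd with even⊎odd t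
... | inj₂ t≡ = t≡
... | inj₁ (u , refl) = contradiction (begin
      0                         ≡⟨ sym ([r+double]%2≡r%2 0 (c + u)) ⟩
      double (c + u) % 2        ≡⟨ cong (_% 2) (double-+ c u) ⟩
      (double c + double u) % 2 ≡⟨ odd ⟩
      1                         ∎) λ ()

even-part : ∀ c t → (double c + t) % 2 ≡ 0 → ∃ λ u → t ≡ double u
even-part c t even with even⊎odd t
... | inj₁ t≡ = t≡
... | inj₂ (u , refl) = contradiction (begin
      1                               ≡⟨ sym ([r+double]%2≡r%2 1 (c + u)) ⟩
      suc (double (c + u)) % 2        ≡⟨ cong (_% 2) (trans (cong suc (double-+ c u)) (sym (+-suc (double c) (double u)))) ⟩
      (double c + suc (double u)) % 2 ≡⟨ even ⟩
      0                               ∎) λ ()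

fib-+ : ∀ m n → fib (m + suc n) ≡ fib m * fib n + fib (suc m) * fib (suc n)
fib-+ zero n = sym (+-identityʳ (fib (suc n)))
fib-+ (suc zero) n = rearrange (fib (suc n)) (fib n)
  where
  rearrange : ∀ y x → y + x ≡ 1 * x + 1 * y
  rearrange = solve-∀
fib-+ (suc (suc m)) n = begin
  fib (suc m + suc n) + fib (m + suc n)
    ≡⟨ cong₂ _+_ (fib-+ (suc m) n) (fib-+ m n) ⟩
  (fib (suc m) * fib n + (fib (suc m) + fib m) * fib (suc n)) + (fib m * fib n + fib (suc m) * fib (suc n))
    ≡⟨ rearrange (fib (suc m)) (fib m) (fib n) (fib (suc n)) ⟩
  (fib (suc m) + fib m) * fib n + ((fib (suc m) + fib m) + fib (suc m)) * fib (suc n) ∎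
  where
  rearrange : ∀ p q x y → (p * x + (p + q) * y) + (q * x + p * y) ≡ (p + q) * x + ((p + q) + p) * y
  rearrange = solve-∀

fib-suc-double : ∀ m → fib (suc (double m)) ≡ fib m * fib m + fib (suc m) * fib (suc m)
fib-suc-double m = trans (cong fib (trans (cong suc (double≡+ m)) (sym (+-suc m m)))) (fib-+ m m)

lucas≡fib+fib : ∀ k → lucas (suc k) ≡ fib (suc (suc k)) + fib k
lucas≡fib+fib zero = refl
lucas≡fib+fib (suc zero) = refl
lucas≡fib+fib (suc (suc k)) = begin
  lucas (suc (suc k)) + lucas (suc k)
    ≡⟨ cong₂ _+_ (lucas≡fib+fib (suc k)) (lucas≡fib+fib k) ⟩
  (fib (suc (suc (suc k))) + fib (suc k)) + (fib (suc (suc k)) + fib k)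
    ≡⟨ +-interchange (fib (suc (suc (suc k)))) (fib (suc k)) (fib (suc (suc k))) (fib k) ⟩
  fib (suc (suc (suc (suc k)))) + fib (suc (suc k)) ∎

-- d'Ocagne's identity F(c+t) F(t+1) - F(c+t+1) F(t) = (-1)^t F(c), without subtraction for each parity of t.
module _ (c : ℕ) where
  private
    step₁ : ∀ t → fib (c + suc t) * fib (suc (suc t)) ≡ fib (suc (c + t)) * fib (suc t) + fib (suc (c + t)) * fib t
    step₁ t = trans (cong (λ k → fib k * fib (suc (suc t))) (+-suc c t))
                    (*-distribˡ-+ (fib (suc (c + t))) (fib (suc t)) (fib t))

    step₂ : ∀ t → fib (suc (c + suc t)) * fib (suc t) ≡ fib (suc (c + t)) * fib (suc t) + fib (c + t) * fib (suc t)
    step₂ t = trans (cong (λ k → fib (suc k) * fib (suc t)) (+-suc c t))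
                    (*-distribʳ-+ (fib (suc t)) (fib (suc (c + t))) (fib (c + t)))

  fib-dOcagne-even : ∀ u → fib (c + double u) * fib (suc (double u)) ≡ fib (suc (c + double u)) * fib (double u) + fib c
  fib-dOcagne-odd : ∀ u → fib (suc (c + suc (double u))) * fib (suc (double u))
                          ≡ fib (c + suc (double u)) * fib (suc (suc (double u))) + fib c

  fib-dOcagne-even zero = begin
    fib (c + 0) * 1     ≡⟨ *-identityʳ _ ⟩
    fib (c + 0)         ≡⟨ cong fib (+-identityʳ c) ⟩
    fib c               ≡⟨ cong (_+ fib c) (sym (*-zeroʳ (fib (suc (c + 0))))) ⟩
    fib (suc (c + 0)) * 0 + fib c ∎
  fib-dOcagne-even (suc u) = begin
    fib (c + suc t) * fib (suc (suc t))                     ≡⟨ step₁ t ⟩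
    fib (suc (c + t)) * fib (suc t) + fib (suc (c + t)) * fib t
      ≡⟨ cong (fib (suc (c + t)) * fib (suc t) +_) (fib-dOcagne-odd u) ⟩
    fib (suc (c + t)) * fib (suc t) + (fib (c + t) * fib (suc t) + fib c)
      ≡⟨ sym (+-assoc (fib (suc (c + t)) * fib (suc t)) (fib (c + t) * fib (suc t)) (fib c)) ⟩
    fib (suc (c + t)) * fib (suc t) + fib (c + t) * fib (suc t) + fib c ≡⟨ cong (_+ fib c) (sym (step₂ t)) ⟩
    fib (suc (c + suc t)) * fib (suc t) + fib c ∎
    where t = suc (double u)
  fib-dOcagne-odd u = begin
    fib (suc (c + suc t)) * fib (suc t)                      ≡⟨ step₂ t ⟩
    fib (suc (c + t)) * fib (suc t) + fib (c + t) * fib (suc t)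
      ≡⟨ cong (fib (suc (c + t)) * fib (suc t) +_) (fib-dOcagne-even u) ⟩
    fib (suc (c + t)) * fib (suc t) + (fib (suc (c + t)) * fib t + fib c)
      ≡⟨ sym (+-assoc (fib (suc (c + t)) * fib (suc t)) (fib (suc (c + t)) * fib t) (fib c)) ⟩
    fib (suc (c + t)) * fib (suc t) + fib (suc (c + t)) * fib t + fib c ≡⟨ cong (_+ fib c) (sym (step₁ t)) ⟩
    fib (c + suc t) * fib (suc (suc t)) + fib c ∎
    where t = double u

fib-sum-odd : ∀ C u → fib (C + double (suc (double u))) + fib C ≡ lucas (C + suc (double u)) * fib (suc (double u))
fib-sum-odd C u = begin
  fib (C + double t) + fib C                ≡⟨ cong (λ k → fib k + fib C) C+2t≡ ⟩
  fib (suc (C + t′) + suc t′) + fib C       ≡⟨ cong (_+ fib C) (fib-+ (suc (C + t′)) t′) ⟩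
  P * fib t′ + Q * fib t + fib C            ≡⟨ +-assoc (P * fib t′) (Q * fib t) (fib C) ⟩
  P * fib t′ + (Q * fib t + fib C)          ≡⟨ +-comm (P * fib t′) (Q * fib t + fib C) ⟩
  Q * fib t + fib C + P * fib t′            ≡⟨ +-assoc (Q * fib t) (fib C) (P * fib t′) ⟩
  Q * fib t + (fib C + P * fib t′)          ≡⟨ cong (Q * fib t +_) (+-comm (fib C) (P * fib t′)) ⟩
  Q * fib t + (P * fib t′ + fib C)          ≡⟨ cong (Q * fib t +_) (sym (fib-dOcagne-even C u)) ⟩
  Q * fib t + R * fib t                     ≡⟨ sym (*-distribʳ-+ (fib t) Q R) ⟩
  (Q + R) * fib t                           ≡⟨ cong (_* fib t) (sym (lucas≡fib+fib (C + t′))) ⟩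
  lucas (suc (C + t′)) * fib t              ≡⟨ cong (λ k → lucas k * fib t) (sym (+-suc C t′)) ⟩
  lucas (C + t) * fib t                     ∎
  where
  t′ = double u
  t = suc t′
  P = fib (suc (C + t′))
  Q = fib (suc (suc (C + t′)))
  R = fib (C + t′)
  C+2t≡ : C + double t ≡ suc (C + t′) + suc t′
  C+2t≡ = trans (cong (C +_) (double≡+ t)) (trans (sym (+-assoc C t t)) (cong (_+ t) (+-suc C t′)))

fib-sum-even : ∀ C u → fib (C + double (double u)) + fib C ≡ fib (C + double u) * lucas (double u)
fib-sum-even C zero = begin
  fib (C + 0) + fib C   ≡⟨ cong (λ k → fib k + fib C) (+-identityʳ C) ⟩
  fib C + fib C         ≡⟨ cong (fib C +_) (sym (+-identityʳ (fib C))) ⟩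
  2 * fib C             ≡⟨ *-comm 2 (fib C) ⟩
  fib C * 2             ≡⟨ cong (λ k → fib k * 2) (sym (+-identityʳ C)) ⟩
  fib (C + 0) * 2       ∎
fib-sum-even C (suc u) = begin
  fib (C + double t) + fib C                ≡⟨ cong (λ k → fib k + fib C) C+2t≡ ⟩
  fib (C + t + suc t′) + fib C              ≡⟨ cong (_+ fib C) (fib-+ (C + t) t′) ⟩
  A * fib t′ + B * fib t + fib C            ≡⟨ +-assoc (A * fib t′) (B * fib t) (fib C) ⟩
  A * fib t′ + (B * fib t + fib C)          ≡⟨ cong (A * fib t′ +_) (sym (fib-dOcagne-even C (suc u))) ⟩
  A * fib t′ + A * fib (suc t)              ≡⟨ sym (*-distribˡ-+ A (fib t′) (fib (suc t))) ⟩
  A * (fib t′ + fib (suc t))                ≡⟨ cong (A *_) (+-comm (fib t′) (fib (suc t))) ⟩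
  A * (fib (suc t) + fib t′)                ≡⟨ cong (A *_) (sym (lucas≡fib+fib t′)) ⟩
  A * lucas t                               ∎
  where
  t = double (suc u)
  t′ = suc (double u)
  A = fib (C + t)
  B = fib (suc (C + t))
  C+2t≡ : C + double t ≡ C + t + suc t′
  C+2t≡ = trans (cong (C +_) (double≡+ t)) (sym (+-assoc C t t))

lucas-double-suc : ∀ n → lucas (double (suc n)) ≡ fib (suc (double (suc n))) + fib (suc (double n))
lucas-double-suc n = lucas≡fib+fib (suc (double n))

lucas-double-odd : ∀ u → lucas (double (suc (double u))) ≡ lucas (suc (double u)) * lucas (suc (double u)) + 2
lucas-double-odd u = begin
  lucas (double (suc n))
    ≡⟨ lucas-double-suc n ⟩
  fib (suc (double (suc n))) + fib (suc (double n))
    ≡⟨ cong₂ _+_ (fib-suc-double (suc n)) (fib-suc-double n) ⟩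
  (y * y + (y + x) * (y + x)) + (x * x + y * y)
    ≡⟨ cong₂ (λ a b → (a + (y + x) * (y + x)) + (x * x + b)) cassini cassini ⟩
  (((y + x) * x + 1) + (y + x) * (y + x)) + (x * x + ((y + x) * x + 1))
    ≡⟨ rearrange x y ⟩
  ((y + x) + x) * ((y + x) + x) + 2
    ≡⟨ cong (λ l → l * l + 2) (sym (lucas≡fib+fib n)) ⟩
  lucas (suc n) * lucas (suc n) + 2 ∎
  where
  n = double u
  x = fib n
  y = fib (suc n)
  cassini : y * y ≡ (y + x) * x + 1
  cassini = fib-dOcagne-even 1 u
  rearrange : ∀ x y → (((y + x) * x + 1) + (y + x) * (y + x)) + (x * x + ((y + x) * x + 1))
                        ≡ ((y + x) + x) * ((y + x) + x) + 2
  rearrange = solve-∀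

lucas-double-even : ∀ u → lucas (double (double u)) ≡ 5 * (fib (double u) * fib (double u)) + 2
lucas-double-even zero = refl
lucas-double-even (suc u) = begin
  lucas (double (suc n))
    ≡⟨ lucas-double-suc n ⟩
  fib (suc (double (suc n))) + fib (suc (double n))
    ≡⟨ cong₂ _+_ (fib-suc-double (suc n)) (fib-suc-double n) ⟩
  (y * y + (y + x) * (y + x)) + (x * x + y * y)
    ≡⟨ rearrange₁ x y ⟩
  3 * (y * y) + 2 * ((y + x) * x)
    ≡⟨ cong (λ k → 3 * (y * y) + 2 * k) cassini ⟩
  3 * (y * y) + 2 * (y * y + 1)
    ≡⟨ rearrange₂ y ⟩
  5 * (y * y) + 2 ∎
  where
  n = suc (double u)
  x = fib n
  y = fib (suc n)
  cassini : (y + x) * x ≡ y * y + 1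
  cassini = fib-dOcagne-odd 1 u
  rearrange₁ : ∀ x y → (y * y + (y + x) * (y + x)) + (x * x + y * y) ≡ 3 * (y * y) + 2 * ((y + x) * x)
  rearrange₁ = solve-∀
  rearrange₂ : ∀ y → 3 * (y * y) + 2 * (y * y + 1) ≡ 5 * (y * y) + 2
  rearrange₂ = solve-∀

-- The forest automaton and the transfer-matrix method

-- A forest of a path is read vertex by vertex; the state records whether the tree
-- currently traversed already contains its root, and a forest is lost (dead) when a
-- tree is closed without a root or receives a second one.
data State : Set where
  unrooted rooted dead : State

_≟ˢ_ : DecidableEquality State
unrooted ≟ˢ unrooted = yes refl
unrooted ≟ˢ rooted = no λ ()
unrooted ≟ˢ dead = no λ ()
rooted ≟ˢ unrooted = no λ ()
rooted ≟ˢ rooted = yes refl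
rooted ≟ˢ dead = no λ ()
dead ≟ˢ unrooted = no λ ()
dead ≟ˢ rooted = no λ ()
dead ≟ˢ dead = yes refl

-- (v is a root , the edge from v to its successor is chosen)
Label : Set
Label = Bool × Bool

step : State → Label → State
step unrooted (false , true) = unrooted
step unrooted (false , false) = dead
step unrooted (true , true) = rooted
step unrooted (true , false) = unrooted
step rooted (false , true) = rooted
step rooted (false , false) = unrooted
step rooted (true , _) = dead
step dead _ = dead

-- (the vertex must be a root , the edge must be chosen)
Constraint : Set
Constraint = Bool × Bool

free : ℕ → Constraint
free _ = (false , false)

sat : Constraint → Label → Bool
sat (ρ , σ) (r , s) = (not ρ ∨ r) ∧ (not σ ∨ s)

stepᶜ : Constraint → State → Label → State
stepᶜ c dead l = dead
stepᶜ c q l = if sat c l then step q l else dead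

run : (ℕ → Constraint) → (ℕ → Label) → State → ℕ → State
run cs L q zero = q
run cs L q (suc k) = run (cs ∘ suc) (L ∘ suc) (stepᶜ (cs 0) q (L 0)) k

run-dead : ∀ cs L k → run cs L dead k ≡ dead
run-dead cs L zero = refl
run-dead cs L (suc k) = run-dead (cs ∘ suc) (L ∘ suc) k

run-+ : ∀ cs L q k l → run cs L q (k + l) ≡ run (cs ∘ (k +_)) (L ∘ (k +_)) (run cs L q k) l
run-+ cs L q zero l = refl
run-+ cs L q (suc k) l = run-+ (cs ∘ suc) (L ∘ suc) _ k l

run-cong : ∀ cs L L′ q k → (∀ t → t < k → L t ≡ L′ t) → run cs L q k ≡ run cs L′ q k
run-cong cs L L′ q zero _ = refl
run-cong cs L L′ q (suc k) L≡ rewrite L≡ 0 z<s = run-cong (cs ∘ suc) (L ∘ suc) (L′ ∘ suc) _ k (λ t t<k → L≡ (suc t) (s<s t<k))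

run-suc : ∀ cs L q k → run cs L q (suc k) ≡ stepᶜ (cs k) (run cs L q k) (L k)
run-suc cs L q k = begin
  run cs L q (suc k)                       ≡⟨ cong (run cs L q) (+-comm 1 k) ⟩
  run cs L q (k + 1)                       ≡⟨ run-+ cs L q k 1 ⟩
  stepᶜ (cs (k + 0)) (run cs L q k) (L (k + 0))
    ≡⟨ cong₂ (λ c l → stepᶜ c (run cs L q k) l) (cong cs (+-identityʳ k)) (cong L (+-identityʳ k)) ⟩
  stepᶜ (cs k) (run cs L q k) (L k)        ∎

stepᶜ-sat : ∀ {c l} q → sat c l ≡ true → stepᶜ c q l ≡ step q l
stepᶜ-sat unrooted sat≡ rewrite sat≡ = refl
stepᶜ-sat rooted sat≡ rewrite sat≡ = refl
stepᶜ-sat dead _ = refl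

stepᶜ-unsat : ∀ {c l} q → sat c l ≡ false → stepᶜ c q l ≡ dead
stepᶜ-unsat unrooted unsat rewrite unsat = refl
stepᶜ-unsat rooted unsat rewrite unsat = refl
stepᶜ-unsat dead _ = refl

run-free : ∀ cs L q k → (∀ p → p < k → sat (cs p) (L p) ≡ true) → run cs L q k ≡ run free L q k
run-free cs L q zero _ = refl
run-free cs L q (suc k) sats = begin
  run (cs ∘ suc) (L ∘ suc) (stepᶜ (cs 0) q (L 0)) k ≡⟨ cong (λ q′ → run (cs ∘ suc) (L ∘ suc) q′ k) (stepᶜ-sat q (sats 0 z<s)) ⟩
  run (cs ∘ suc) (L ∘ suc) (step q (L 0)) k         ≡⟨ run-free (cs ∘ suc) (L ∘ suc) _ k (λ p p<k → sats (suc p) (s<s p<k)) ⟩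
  run free (L ∘ suc) (step q (L 0)) k               ≡⟨ cong (λ q′ → run free (L ∘ suc) q′ k) (sym (stepᶜ-sat q refl)) ⟩
  run free (L ∘ suc) (stepᶜ (free 0) q (L 0)) k     ∎

run-sat : ∀ cs L q k → run cs L q k ≢ dead → ∀ p → p < k → sat (cs p) (L p) ≡ true
run-sat cs L q (suc k) alive p p<k with sat (cs 0) (L 0) in sat₀
run-sat cs L q (suc k) alive zero _ | true = sat₀
run-sat cs L q (suc k) alive (suc p) (s<s p<k) | true = run-sat (cs ∘ suc) (L ∘ suc) _ k alive p p<k
... | false = ⊥-elim (alive (trans (cong (λ q′ → run (cs ∘ suc) (L ∘ suc) q′ k) (stepᶜ-unsat q sat₀))
                                   (run-dead (cs ∘ suc) (L ∘ suc) k)))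

data Mat : Set where
  mk : ℕ → ℕ → ℕ → ℕ → Mat

mk-cong : ∀ {a b c d a′ b′ c′ d′} → a ≡ a′ → b ≡ b′ → c ≡ c′ → d ≡ d′ → mk a b c d ≡ mk a′ b′ c′ d′
mk-cong refl refl refl refl = refl

entry : Mat → State → State → ℕ
entry _ dead _ = 0
entry _ _ dead = 0
entry (mk a b c d) unrooted unrooted = a
entry (mk a b c d) unrooted rooted = b
entry (mk a b c d) rooted unrooted = c
entry (mk a b c d) rooted rooted = d

infixl 7 _⊗_
_⊗_ : Mat → Mat → Mat
mk a b c d ⊗ mk e f g h = mk (a * e + b * g) (a * f + b * h) (c * e + d * g) (c * f + d * h)

𝟙 : Mat
𝟙 = mk 1 0 0 1

trace : Mat → ℕ
trace (mk a b c d) = a + d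

trace≡entries : ∀ A → trace A ≡ entry A unrooted unrooted + entry A rooted rooted
trace≡entries (mk a b c d) = refl

entry-⊗ : ∀ A B q q′ → q′ ≢ dead →
          entry (A ⊗ B) q q′ ≡ entry A q unrooted * entry B unrooted q′ + entry A q rooted * entry B rooted q′
entry-⊗ _ _ dead _ _ = refl
entry-⊗ _ _ _ dead live = ⊥-elim (live refl)
entry-⊗ (mk _ _ _ _) (mk _ _ _ _) unrooted unrooted _ = refl
entry-⊗ (mk _ _ _ _) (mk _ _ _ _) unrooted rooted _ = refl
entry-⊗ (mk _ _ _ _) (mk _ _ _ _) rooted unrooted _ = refl
entry-⊗ (mk _ _ _ _) (mk _ _ _ _) rooted rooted _ = refl

⊗-assoc : ∀ A B C → (A ⊗ B) ⊗ C ≡ A ⊗ (B ⊗ C)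
⊗-assoc (mk a b c d) (mk e f g h) (mk i j k l) = mk-cong (assoc a b e f g h i k) (assoc a b e f g h j l)
                                                         (assoc c d e f g h i k) (assoc c d e f g h j l)
  where
  assoc : ∀ a b e f g h i k → (a * e + b * g) * i + (a * f + b * h) * k ≡ a * (e * i + f * k) + b * (g * i + h * k)
  assoc = solve-∀

⊗-identityˡ : ∀ A → 𝟙 ⊗ A ≡ A
⊗-identityˡ (mk a b c d) = mk-cong (identity a c) (identity b d) (+-identityʳ c) (+-identityʳ d)
  where
  identity : ∀ x y → 1 * x + 0 * y ≡ x
  identity = solve-∀

⊗-identityʳ : ∀ A → A ⊗ 𝟙 ≡ A
⊗-identityʳ (mk a b c d) = mk-cong (identity a b) (identity′ a b) (identity c d) (identity′ c d)
  where
  identity : ∀ x y → x * 1 + y * 0 ≡ x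
  identity = solve-∀
  identity′ : ∀ x y → x * 0 + y * 1 ≡ y
  identity′ = solve-∀

trace-comm : ∀ A B → trace (A ⊗ B) ≡ trace (B ⊗ A)
trace-comm (mk a b c d) (mk e f g h) = comm a b c d e f g h
  where
  comm : ∀ a b c d e f g h → (a * e + b * g) + (c * f + d * h) ≡ (e * a + f * c) + (g * b + h * d)
  comm = solve-∀

trace-rotate : ∀ A B C → trace (A ⊗ (B ⊗ C)) ≡ trace (B ⊗ (C ⊗ A))
trace-rotate A B C = trans (trace-comm A (B ⊗ C)) (cong trace (⊗-assoc B C A))

infixr 8 _^ᴹ_
_^ᴹ_ : Mat → ℕ → Mat
A ^ᴹ zero = 𝟙
A ^ᴹ suc k = A ⊗ A ^ᴹ k

^ᴹ-+ : ∀ A k l → A ^ᴹ (k + l) ≡ A ^ᴹ k ⊗ A ^ᴹ l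
^ᴹ-+ A zero l = sym (⊗-identityˡ (A ^ᴹ l))
^ᴹ-+ A (suc k) l = trans (cong (A ⊗_) (^ᴹ-+ A k l)) (sym (⊗-assoc A (A ^ᴹ k) (A ^ᴹ l)))

indicator : Bool → ℕ
indicator b = if b then 1 else 0

count : {A : Set} → (A → Bool) → List A → ℕ
count p xs = sum (map (indicator ∘ p) xs)

module _ {A : Set} where

  count-++ : ∀ (p : A → Bool) xs ys → count p (xs ++ ys) ≡ count p xs + count p ys
  count-++ p xs ys = trans (cong sum (map-++ (indicator ∘ p) xs ys)) (sum-++ (map (indicator ∘ p) xs) _)

  count-map : ∀ {B : Set} (p : B → Bool) (f : A → B) xs → count p (map f xs) ≡ count (p ∘ f) xs
  count-map p f xs = cong sum (sym (map-∘ xs))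

  count-∨ : ∀ (p q : A → Bool) → (∀ x → p x ≡ true → q x ≡ true → ⊥) → ∀ xs →
            count (λ x → p x ∨ q x) xs ≡ count p xs + count q xs
  count-∨ p q disjoint [] = refl
  count-∨ p q disjoint (x ∷ xs) with p x in px | q x in qx
  ... | true | true = ⊥-elim (disjoint x px qx)
  ... | true | false = cong suc (count-∨ p q disjoint xs)
  ... | false | true = trans (cong suc (count-∨ p q disjoint xs)) (sym (+-suc (count p xs) (count q xs)))
  ... | false | false = count-∨ p q disjoint xs

  count-∧-not : ∀ (p q : A → Bool) → (∀ x → q x ≡ true → p x ≡ true) → ∀ xs →
                count (λ x → p x ∧ not (q x)) xs + count q xs ≡ count p xs
  count-∧-not p q q⇒p [] = refl
  count-∧-not p q q⇒p (x ∷ xs) with p x in px | q x in qx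
  ... | true | true = trans (+-suc _ _) (cong suc (count-∧-not p q q⇒p xs))
  ... | true | false = cong suc (count-∧-not p q q⇒p xs)
  ... | false | true = contradiction (trans (sym px) (q⇒p x qx)) λ ()
  ... | false | false = count-∧-not p q q⇒p xs

  length-filterᵇ : ∀ (p : A → Bool) xs → length (filterᵇ p xs) ≡ count p xs
  length-filterᵇ p [] = refl
  length-filterᵇ p (x ∷ xs) with p x
  ... | true = cong suc (length-filterᵇ p xs)
  ... | false = length-filterᵇ p xs

  card-count : ∀ (P : A → Set) (p : A → Bool) xs → Unique xs → (∀ x → x ∈ xs) →
               (∀ x → p x ≡ true ⇔ P x) → Card P (count p xs)
  card-count P p xs unique complete p⇔P =
    filterᵇ p xs , filter⁺ (T? ∘ p) unique , (λ x → mk⇔ (from-filter x) (to-filter x)) , length-filterᵇ p xs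
    where
    from-filter : ∀ x → x ∈ filterᵇ p xs → P x
    from-filter x x∈ = Equivalence.to (p⇔P x) (Equivalence.to T-≡ (proj₂ (∈-filter⁻ (T? ∘ p) {xs = xs} x∈)))
    to-filter : ∀ x → P x → x ∈ filterᵇ p xs
    to-filter x Px = ∈-filter⁺ (T? ∘ p) (complete x) (Equivalence.from T-≡ (Equivalence.from (p⇔P x) Px))

  sum-map-linear : ∀ (f g : A → ℕ) a b xs → sum (map (λ x → f x * a + g x * b) xs) ≡ sum (map f xs) * a + sum (map g xs) * b
  sum-map-linear f g a b [] = refl
  sum-map-linear f g a b (x ∷ xs) = trans (cong (f x * a + g x * b +_) (sum-map-linear f g a b xs))
                                          (regroup (f x) (g x) (sum (map f xs)) (sum (map g xs)) a b)
    where
    regroup : ∀ u v U V a b → u * a + v * b + (U * a + V * b) ≡ (u + U) * a + (v + V) * b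
    regroup = solve-∀

count-cartesianProductWith : ∀ {A B C : Set} (p : C → Bool) (f : A → B → C) xs ys →
  count p (cartesianProductWith f xs ys) ≡ sum (map (λ x → count (p ∘ f x) ys) xs)
count-cartesianProductWith p f [] ys = refl
count-cartesianProductWith p f (x ∷ xs) ys =
  trans (count-++ p (map (f x) ys) _) (cong₂ _+_ (count-map p (f x) ys) (count-cartesianProductWith p f xs ys))

bools : List Bool
bools = false ∷ true ∷ []

labels : List Label
labels = cartesianProduct bools bools

bools-unique : Unique bools
bools-unique = ((λ ()) ∷ []) ∷ [] ∷ []

bools-complete : ∀ b → b ∈ bools
bools-complete false = here refl
bools-complete true = there (here refl)

-- (chosen edges S , roots R), as in RootedForest
Configuration : ℕ → Set
Configuration n = Vec Bool n × Vec Bool n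

at : ∀ {n} → Vec Bool n → ℕ → Bool
at [] _ = false
at (b ∷ _) zero = b
at (_ ∷ v) (suc t) = at v t

labelAt : ∀ {n} → Configuration n → ℕ → Label
labelAt (S , R) t = (at R t , at S t)

prepend : ∀ {n} → Label → Configuration n → Configuration (suc n)
prepend (r , s) (S , R) = (s ∷ S , r ∷ R)

prepend-injective : ∀ {n l l′} {x x′ : Configuration n} → prepend l x ≡ prepend l′ x′ → l ≡ l′ × x ≡ x′
prepend-injective {l = _ , _} {_ , _} {_ , _} {_ , _} refl = refl , refl

configurations : (n : ℕ) → List (Configuration n)
configurations zero = ([] , []) ∷ []
configurations (suc n) = cartesianProductWith prepend labels (configurations n)

configurations-unique : ∀ n → Unique (configurations n)
configurations-unique zero = [] ∷ []
configurations-unique (suc n) = cartesianProductWith⁺ prepend prepend-injective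
  (cartesianProduct⁺ bools-unique bools-unique) (configurations-unique n)

configurations-complete : ∀ n (x : Configuration n) → x ∈ configurations n
configurations-complete zero ([] , []) = here refl
configurations-complete (suc n) (s ∷ S , r ∷ R) = ∈-cartesianProductWith⁺ prepend
  (∈-cartesianProduct⁺ (bools-complete r) (bools-complete s)) (configurations-complete n (S , R))

transitions : Constraint → State → State → ℕ
transitions c q q′ = count (λ l → does (stepᶜ c q l ≟ˢ q′)) labels

transfer : Constraint → Mat
transfer c = mk (transitions c unrooted unrooted) (transitions c unrooted rooted)
                (transitions c rooted unrooted) (transitions c rooted rooted)

transferProduct : (ℕ → Constraint) → ℕ → Mat
transferProduct cs zero = 𝟙
transferProduct cs (suc n) = transfer (cs 0) ⊗ transferProduct (cs ∘ suc) n

entry-transfer : ∀ c q q′ → q′ ≢ dead → entry (transfer c) q q′ ≡ transitions c q q′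
entry-transfer c _ dead live = ⊥-elim (live refl)
entry-transfer c unrooted unrooted _ = refl
entry-transfer c unrooted rooted _ = refl
entry-transfer c rooted unrooted _ = refl
entry-transfer c rooted rooted _ = refl
entry-transfer c dead unrooted _ = refl
entry-transfer c dead rooted _ = refl

entry-decompose : ∀ P q q′ → entry P q q′ ≡
  indicator (does (q ≟ˢ unrooted)) * entry P unrooted q′ + indicator (does (q ≟ˢ rooted)) * entry P rooted q′
entry-decompose P unrooted q′ = first (entry P unrooted q′) (entry P rooted q′)
  where
  first : ∀ x y → x ≡ 1 * x + 0 * y
  first = solve-∀
entry-decompose P rooted q′ = sym (+-identityʳ (entry P rooted q′))
entry-decompose P dead q′ = refl

transfer-step : ∀ c q q′ P → q′ ≢ dead →
  sum (map (λ l → entry P (stepᶜ c q l) q′) labels) ≡ entry (transfer c ⊗ P) q q′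
transfer-step c q q′ P live = begin
  sum (map (λ l → entry P (stepᶜ c q l) q′) labels)
    ≡⟨ cong sum (map-cong (λ l → entry-decompose P (stepᶜ c q l) q′) labels) ⟩
  sum (map (λ l → into unrooted l * a + into rooted l * b) labels)
    ≡⟨ sum-map-linear (into unrooted) (into rooted) a b labels ⟩
  transitions c q unrooted * a + transitions c q rooted * b
    ≡⟨ sym (cong₂ (λ x y → x * a + y * b) (entry-transfer c q unrooted (λ ())) (entry-transfer c q rooted (λ ()))) ⟩
  entry (transfer c) q unrooted * a + entry (transfer c) q rooted * b
    ≡⟨ sym (entry-⊗ (transfer c) P q q′ live) ⟩
  entry (transfer c ⊗ P) q q′ ∎
  where
  a = entry P unrooted q′
  b = entry P rooted q′
  into : State → Label → ℕ
  into q″ l = indicator (does (stepᶜ c q l ≟ˢ q″))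

count-runs : ∀ cs n q q′ → q′ ≢ dead →
  count (λ x → does (run cs (labelAt x) q n ≟ˢ q′)) (configurations n) ≡ entry (transferProduct cs n) q q′
count-runs cs zero q dead live = ⊥-elim (live refl)
count-runs cs zero unrooted unrooted _ = refl
count-runs cs zero unrooted rooted _ = refl
count-runs cs zero rooted unrooted _ = refl
count-runs cs zero rooted rooted _ = refl
count-runs cs zero dead unrooted _ = refl
count-runs cs zero dead rooted _ = refl
count-runs cs (suc n) q q′ live = begin
  count (λ x → does (run cs (labelAt x) q (suc n) ≟ˢ q′)) (configurations (suc n))
    ≡⟨ count-cartesianProductWith _ prepend labels (configurations n) ⟩
  sum (map (λ l → count (λ y → does (run (cs ∘ suc) (labelAt y) (stepᶜ (cs 0) q l) n ≟ˢ q′)) (configurations n)) labels)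
    ≡⟨ cong sum (map-cong (λ l → count-runs (cs ∘ suc) n (stepᶜ (cs 0) q l) q′ live) labels) ⟩
  sum (map (λ l → entry (transferProduct (cs ∘ suc) n) (stepᶜ (cs 0) q l) q′) labels)
    ≡⟨ transfer-step (cs 0) q q′ (transferProduct (cs ∘ suc) n) live ⟩
  entry (transferProduct cs (suc n)) q q′ ∎

-- Rooted forests of a path

Linked : (ℕ → Bool) → ℕ → ℕ → Set
Linked s a b = ∀ t → a ≤ t → t < b → s t ≡ true

Joined : (ℕ → Bool) → ℕ → ℕ → Set
Joined s a b = (a ≤ b × Linked s a b) ⊎ (b ≤ a × Linked s b a)

<-suc-split : ∀ {b v} → b < suc v → b < v ⊎ b ≡ v
<-suc-split (s≤s b≤v) = m≤n⇒m<n∨m≡n b≤v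

-- r v: vertex v is a root; s v: the edge from v to v + 1 is chosen
module PathForest (r s : ℕ → Bool) where

  labelsOf : ℕ → Label
  labelsOf t = (r t , s t)

  state : ℕ → State
  state v = run free labelsOf unrooted v

  state-suc : ∀ v → state (suc v) ≡ step (state v) (r v , s v)
  state-suc v = trans (run-suc free labelsOf unrooted v) (stepᶜ-sat (state v) refl)

  RootsApart : ℕ → Set
  RootsApart v = ∀ a b → a < b → b < v → r a ≡ true → r b ≡ true → ¬ Linked s a b

  RootedBefore : ℕ → ℕ → Set
  RootedBefore v a = ∃ λ b → b < v × r b ≡ true × Joined s a b

  CoveredOrOpen : ℕ → Set
  CoveredOrOpen v = ∀ a → a < v → Linked s a v ⊎ RootedBefore v a

  OpenRooted : ℕ → Set
  OpenRooted v = ∃ λ b → b < v × r b ≡ true × Linked s b v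

  Covered : ℕ → Set
  Covered v = ∀ a → a < v → RootedBefore v a

  private
    linked-suc : ∀ {a v} → Linked s a v → s v ≡ true → Linked s a (suc v)
    linked-suc {a} {v} h sv t a≤t (s≤s t≤v) with m≤n⇒m<n∨m≡n t≤v
    ... | inj₁ t<v = h t a≤t t<v
    ... | inj₂ refl = sv

    linked-mono : ∀ {a b a′ b′} → a ≤ a′ → b′ ≤ b → Linked s a b → Linked s a′ b′
    linked-mono a≤a′ b′≤b h t a′≤t t<b′ = h t (≤-trans a≤a′ a′≤t) (<-≤-trans t<b′ b′≤b)

    linked-pred : ∀ {a v} → Linked s a (suc v) → Linked s a v
    linked-pred = linked-mono ≤-refl (n≤1+n _)

    linked-last : ∀ {a v} → Linked s a (suc v) → a ≤ v → s v ≡ true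
    linked-last h a≤v = h _ a≤v ≤-refl

    linked-refl : ∀ a → Linked s a a
    linked-refl a t a≤t t<a = ⊥-elim (<-irrefl refl (≤-<-trans a≤t t<a))

    rooted-suc : ∀ {v a} → RootedBefore v a → RootedBefore (suc v) a
    rooted-suc (b , b<v , rb , j) = b , <-trans b<v (n<1+n _) , rb , j

    apart-pred : ∀ {v} → RootsApart (suc v) → RootsApart v
    apart-pred h a b a<b b<v = h a b a<b (<-trans b<v (n<1+n _))

    apart-nonroot : ∀ {v} → RootsApart v → r v ≡ false → RootsApart (suc v)
    apart-nonroot {v} h rv a b a<b b<sv ra rb ab with <-suc-split b<sv
    ... | inj₁ b<v = h a b a<b b<v ra rb ab
    ... | inj₂ refl with trans (sym rb) rv
    ... | ()

    apart-root : ∀ {v} → RootsApart v → ¬ OpenRooted v → RootsApart (suc v)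
    apart-root {v} h ¬open a b a<b b<sv ra rb ab with <-suc-split b<sv
    ... | inj₁ b<v = h a b a<b b<v ra rb ab
    ... | inj₂ refl = ¬open (a , a<b , ra , ab)

    covered-pred : ∀ {v} → CoveredOrOpen (suc v) → CoveredOrOpen v
    covered-pred {v} h a a<v with h a (<-trans a<v (n<1+n v))
    ... | inj₁ av = inj₁ (linked-pred av)
    ... | inj₂ (b , b<sv , rb , ab) with <-suc-split b<sv
    ... | inj₁ b<v = inj₂ (b , b<v , rb , ab)
    ... | inj₂ refl with ab
    ... | inj₁ (_ , av) = inj₁ av
    ... | inj₂ (v≤a , _) = ⊥-elim (<-irrefl refl (<-≤-trans a<v v≤a))

    covered-edge : ∀ {v} → CoveredOrOpen v → s v ≡ true → CoveredOrOpen (suc v)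
    covered-edge {v} h sv a a<sv with <-suc-split a<sv
    ... | inj₂ refl = inj₁ (linked-suc (linked-refl v) sv)
    ... | inj₁ a<v with h a a<v
    ... | inj₁ av = inj₁ (linked-suc av sv)
    ... | inj₂ x = inj₂ (rooted-suc x)

    covered-root : ∀ {v} → CoveredOrOpen v → r v ≡ true → CoveredOrOpen (suc v)
    covered-root {v} h rv a a<sv with <-suc-split a<sv
    ... | inj₂ refl = inj₂ (v , n<1+n v , rv , inj₁ (≤-refl , linked-refl v))
    ... | inj₁ a<v with h a a<v
    ... | inj₁ av = inj₂ (v , n<1+n v , rv , inj₁ (<⇒≤ a<v , av))
    ... | inj₂ x = inj₂ (rooted-suc x)

    covered-close : ∀ {v} → CoveredOrOpen v → OpenRooted v → CoveredOrOpen (suc v)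
    covered-close {v} h (b , b<v , rb , bv) a a<sv with <-suc-split a<sv
    ... | inj₂ refl = inj₂ (b , <-trans b<v (n<1+n v) , rb , inj₂ (<⇒≤ b<v , bv))
    ... | inj₁ a<v with h a a<v
    ... | inj₂ x = inj₂ (rooted-suc x)
    ... | inj₁ av with ≤-total a b
    ... | inj₁ a≤b = inj₂ (b , <-trans b<v (n<1+n v) , rb , inj₁ (a≤b , linked-mono ≤-refl (<⇒≤ b<v) av))
    ... | inj₂ b≤a = inj₂ (b , <-trans b<v (n<1+n v) , rb , inj₂ (b≤a , linked-mono ≤-refl (<⇒≤ a<v) bv))

    unrooted-nonroot : ∀ {v} → ¬ OpenRooted v → r v ≡ false → ¬ OpenRooted (suc v)
    unrooted-nonroot {v} h rv (b , b<sv , rb , bv) with <-suc-split b<sv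
    ... | inj₁ b<v = h (b , b<v , rb , linked-pred bv)
    ... | inj₂ refl with trans (sym rb) rv
    ... | ()

    unrooted-cut : ∀ {v} → s v ≡ false → ¬ OpenRooted (suc v)
    unrooted-cut sv (b , b<sv , rb , bv) with trans (sym (linked-last bv (<⇒≤pred b<sv))) sv
    ... | ()

    rooted-here : ∀ {v} → r v ≡ true → s v ≡ true → OpenRooted (suc v)
    rooted-here {v} rv sv = v , n<1+n v , rv , linked-suc (linked-refl v) sv

    rooted-edge : ∀ {v} → OpenRooted v → s v ≡ true → OpenRooted (suc v)
    rooted-edge (b , b<v , rb , bv) sv = b , <-trans b<v (n<1+n _) , rb , linked-suc bv sv

  Invariant : State → ℕ → Set
  Invariant unrooted v = RootsApart v × CoveredOrOpen v × ¬ OpenRooted v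
  Invariant rooted v = RootsApart v × CoveredOrOpen v × OpenRooted v
  Invariant dead v = ⊤

  invariant-step : ∀ v q → Invariant q v → Invariant (step q (r v , s v)) (suc v)
  invariant-step v unrooted (ap , co , ¬or) with r v in rv | s v in sv
  ... | false | true = apart-nonroot ap rv , covered-edge co sv , unrooted-nonroot ¬or rv
  ... | true | false = apart-root ap ¬or , covered-root co rv , unrooted-cut sv
  ... | true | true = apart-root ap ¬or , covered-root co rv , rooted-here rv sv
  ... | false | false = tt
  invariant-step v rooted (ap , co , or) with r v in rv | s v in sv
  ... | false | true = apart-nonroot ap rv , covered-edge co sv , rooted-edge or sv
  ... | false | false = apart-nonroot ap rv , covered-close co or , unrooted-cut sv
  ... | true | _ = tt
  invariant-step v dead _ = tt

  invariant : ∀ v → Invariant (state v) v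
  invariant zero = (λ _ _ _ ()) , (λ _ ()) , (λ { (_ , () , _) })
  invariant (suc v) = subst (λ q → Invariant q (suc v)) (sym (state-suc v)) (invariant-step v (state v) (invariant v))

  private
    unrooted-survives : ∀ {v} → ¬ OpenRooted v → CoveredOrOpen (suc v) → step unrooted (r v , s v) ≢ dead
    unrooted-survives {v} ¬open co dies with r v in rv | s v in sv | co v (n<1+n v)
    unrooted-survives _ _ () | false | true | _
    unrooted-survives _ _ () | true | false | _
    unrooted-survives _ _ () | true | true | _
    ... | false | false | inj₁ vv with trans (sym (linked-last vv ≤-refl)) sv
    ... | ()
    unrooted-survives {v} ¬open co dies | false | false | inj₂ (b , b<sv , rb , vb) with <-suc-split b<sv | vb
    ... | inj₂ refl | _ with trans (sym rb) rv
    ... | ()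
    unrooted-survives _ _ _ | false | false | inj₂ _ | inj₁ b<v | inj₁ (v≤b , _) = <-irrefl refl (<-≤-trans b<v v≤b)
    unrooted-survives ¬open _ _ | false | false | inj₂ (b , _ , rb , _) | inj₁ b<v | inj₂ (_ , bv) = ¬open (b , b<v , rb , bv)

    rooted-survives : ∀ {v} → OpenRooted v → RootsApart (suc v) → step rooted (r v , s v) ≢ dead
    rooted-survives {v} (b , b<v , rb , bv) ap dies with r v in rv | s v in sv
    rooted-survives _ _ () | false | true
    rooted-survives _ _ () | false | false
    ... | true | _ = ap b v b<v (n<1+n v) rb rv bv

    step-from : ∀ {v q} → state v ≡ q → state (suc v) ≡ step q (r v , s v)
    step-from refl = state-suc _

  alive : ∀ v → RootsApart v → CoveredOrOpen v → state v ≢ dead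
  alive zero _ _ ()
  alive (suc v) ap co dies with state v in state≡ | invariant v | alive v (apart-pred ap) (covered-pred co)
  ... | dead | _ | alive-v = alive-v refl
  ... | unrooted | (_ , _ , ¬open) | _ = unrooted-survives ¬open co (trans (sym (step-from state≡)) dies)
  ... | rooted | (_ , _ , rooted-v) | _ = rooted-survives rooted-v ap (trans (sym (step-from state≡)) dies)

  path-forest⇒ : ∀ k → s k ≡ false → state (suc k) ≡ unrooted → Covered (suc k) × RootsApart (suc k)
  path-forest⇒ k sk final with subst (λ q → Invariant q (suc k)) final (invariant (suc k))
  ... | (ap , co , _) = covered , ap
    where
    covered : Covered (suc k)
    covered a a<sk with co a a<sk
    ... | inj₂ x = x
    ... | inj₁ ak with trans (sym (linked-last ak (<⇒≤pred a<sk))) sk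
    ... | ()

  path-forest⇐ : ∀ k → s k ≡ false → Covered (suc k) → RootsApart (suc k) → state (suc k) ≡ unrooted
  path-forest⇐ k sk covered ap with state (suc k) in final | invariant (suc k)
  ... | unrooted | _ = refl
  ... | rooted | (_ , _ , rooted-k) = ⊥-elim (unrooted-cut sk rooted-k)
  ... | dead | _ = ⊥-elim (alive (suc k) ap (λ a a<sk → inj₂ (covered a a<sk)) final)

module CycleOn (m : ℕ) where

  N : ℕ
  N = suc m

  next : Fin N → Fin N
  next v = fromℕ< (m%n<n (suc (toℕ v)) N)

  toℕ-next : ∀ v → suc (toℕ v) < N → toℕ (next v) ≡ suc (toℕ v)
  toℕ-next v lt = trans (toℕ-fromℕ< (m%n<n (suc (toℕ v)) N)) (m<n⇒m%n≡m lt)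

  next-last : ∀ v → suc (toℕ v) ≡ N → next v ≡ zero
  next-last v eq = toℕ-injective (trans (toℕ-fromℕ< (m%n<n (suc (toℕ v)) N)) (trans (cong (_% N) eq) (n%n≡0 N)))

  advance : ℕ → Fin N → Fin N
  advance zero v = v
  advance (suc k) v = next (advance k v)

  advance-+ : ∀ a b v → advance (a + b) v ≡ advance a (advance b v)
  advance-+ zero b v = refl
  advance-+ (suc a) b v = cong next (advance-+ a b v)

  toℕ-advance : ∀ k → k < N → toℕ (advance k zero) ≡ k
  toℕ-advance zero _ = refl
  toℕ-advance (suc k) lt =
    trans (toℕ-next (advance k zero) (subst (λ x → suc x < N) (sym ih) lt)) (cong suc ih)
    where ih = toℕ-advance k (<-trans (n<1+n k) lt)

  advance-toℕ : ∀ v → advance (toℕ v) zero ≡ v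
  advance-toℕ v = toℕ-injective (toℕ-advance (toℕ v) (toℕ<n v))

  advance-N-zero : advance N zero ≡ zero
  advance-N-zero = next-last (advance m zero) (cong suc (toℕ-advance m (n<1+n m)))

  advance-N : ∀ v → advance N v ≡ v
  advance-N v = begin
    advance N v                        ≡⟨ cong (advance N) (sym (advance-toℕ v)) ⟩
    advance N (advance (toℕ v) zero)   ≡⟨ sym (advance-+ N (toℕ v) zero) ⟩
    advance (N + toℕ v) zero           ≡⟨ cong (λ k → advance k zero) (+-comm N (toℕ v)) ⟩
    advance (toℕ v + N) zero           ≡⟨ advance-+ (toℕ v) N zero ⟩
    advance (toℕ v) (advance N zero)   ≡⟨ cong (advance (toℕ v)) advance-N-zero ⟩
    advance (toℕ v) zero               ≡⟨ advance-toℕ v ⟩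
    v                                  ∎

  advance-next : ∀ k v → advance k (next v) ≡ advance (suc k) v
  advance-next k v = trans (sym (advance-+ k 1 v)) (cong (λ x → advance x v) (+-comm k 1))

  next-injective : ∀ {u v} → next u ≡ next v → u ≡ v
  next-injective {u} {v} eq = begin
    u                  ≡⟨ sym (advance-N u) ⟩
    advance N u        ≡⟨ sym (advance-next m u) ⟩
    advance m (next u) ≡⟨ cong (advance m) eq ⟩
    advance m (next v) ≡⟨ advance-next m v ⟩
    advance N v        ≡⟨ advance-N v ⟩
    v                  ∎

  advance-from-zero : ∀ c w → advance c w ≡ advance (c + toℕ w) zero
  advance-from-zero c w = trans (cong (advance c) (sym (advance-toℕ w))) (sym (advance-+ c (toℕ w) zero))

  advance-no-fixpoint : ∀ c w → 0 < c → c < N → advance c w ≢ w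
  advance-no-fixpoint c w 0<c c<N eq with c + toℕ w <? N
  ... | yes lt = <-irrefl p≡c+p (m<n+m (toℕ w) 0<c)
    where
    p≡c+p : toℕ w ≡ c + toℕ w
    p≡c+p = trans (sym (toℕ-advance (toℕ w) (toℕ<n w)))
              (trans (cong toℕ (trans (advance-toℕ w) (trans (sym eq) (advance-from-zero c w)))) (toℕ-advance _ lt))
  ... | no ge = <-irrefl (sym p≡r) r<p
    where
    p = toℕ w
    r = c + p ∸ N
    r+N≡ : r + N ≡ c + p
    r+N≡ = m∸n+n≡m (≮⇒≥ ge)
    r<p : r < p
    r<p = +-cancelʳ-< N r p (subst (_< p + N) (sym r+N≡) (subst (c + p <_) (+-comm N p) (+-monoˡ-< p c<N)))
    w≡ : w ≡ advance r zero
    w≡ = trans (sym eq) (trans (advance-from-zero c w) (trans (cong (λ x → advance x zero) (sym r+N≡))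
           (trans (advance-+ r N zero) (cong (advance r) advance-N-zero))))
    p≡r : p ≡ r
    p≡r = trans (cong toℕ w≡) (toℕ-advance r (<-trans r<p (toℕ<n w)))

  advance-injectiveˡ : ∀ {a b} v → a < N → b < N → advance a v ≡ advance b v → a ≡ b
  advance-injectiveˡ {a} {b} v a<N b<N eq with <-cmp a b
  ... | tri≈ _ a≡b _ = a≡b
  ... | tri< a<b _ _ = ⊥-elim (advance-no-fixpoint (b ∸ a) (advance a v) (m<n⇒0<n∸m a<b) (≤-<-trans (m∸n≤m b a) b<N)
        (trans (sym (advance-+ (b ∸ a) a v)) (trans (cong (λ x → advance x v) (m∸n+n≡m (<⇒≤ a<b))) (sym eq))))
  ... | tri> _ _ b<a = ⊥-elim (advance-no-fixpoint (a ∸ b) (advance b v) (m<n⇒0<n∸m b<a) (≤-<-trans (m∸n≤m a b) a<N)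
        (trans (sym (advance-+ (a ∸ b) b v)) (trans (cong (λ x → advance x v) (m∸n+n≡m (<⇒≤ b<a))) eq)))

  clockwise : ℕ → ℕ → ℕ
  clockwise a b with a ≤? b
  ... | yes _ = b ∸ a
  ... | no _ = N ∸ a + b

  clockwise-≤ : ∀ {a b} → a ≤ b → clockwise a b ≡ b ∸ a
  clockwise-≤ {a} {b} a≤b with a ≤? b
  ... | yes _ = refl
  ... | no a≰b = ⊥-elim (a≰b a≤b)

  clockwise-> : ∀ {a b} → b < a → clockwise a b ≡ N ∸ a + b
  clockwise-> {a} {b} b<a with a ≤? b
  ... | yes a≤b = ⊥-elim (<⇒≱ b<a a≤b)
  ... | no _ = refl

  clockwise-spec : ∀ a b → a < N → b < N → clockwise a b < N × advance (clockwise a b) (advance a zero) ≡ advance b zero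
  clockwise-spec a b a<N b<N with a ≤? b
  ... | yes a≤b = ≤-<-trans (m∸n≤m b a) b<N ,
                  trans (sym (advance-+ (b ∸ a) a zero)) (cong (λ x → advance x zero) (m∸n+n≡m a≤b))
  ... | no a≰b = lt , trans (sym (advance-+ (N ∸ a + b) a zero))
                   (trans (cong (λ x → advance x zero) around) (trans (advance-+ b N zero) (cong (advance b) advance-N-zero)))
    where
    lt : N ∸ a + b < N
    lt = subst (N ∸ a + b <_) (m∸n+n≡m (<⇒≤ a<N)) (+-monoʳ-< (N ∸ a) (≰⇒> a≰b))
    around : N ∸ a + b + a ≡ b + N
    around = trans (+-assoc (N ∸ a) b a) (trans (cong (N ∸ a +_) (+-comm b a)) (trans (sym (+-assoc (N ∸ a) a b))
               (trans (cong (_+ b) (m∸n+n≡m (<⇒≤ a<N))) (+-comm N b))))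

  advance-surjective : ∀ u v → ∃ λ k → k < N × advance k u ≡ v
  advance-surjective u v = clockwise (toℕ u) (toℕ v) , proj₁ spec ,
    trans (cong (advance (clockwise (toℕ u) (toℕ v))) (sym (advance-toℕ u))) (trans (proj₂ spec) (advance-toℕ v))
    where spec = clockwise-spec (toℕ u) (toℕ v) (toℕ<n u) (toℕ<n v)

  G : Graph N N
  G = cycleGraph N

  lookup-G : ∀ e → lookup G e ≡ (e , next e)
  lookup-G e = lookup∘tabulate (λ k → k , next k) e

  CycleAdj : Vec Bool N → Fin N → Fin N → Set
  CycleAdj S u v = (lookup S u ≡ true × next u ≡ v) ⊎ (lookup S v ≡ true × next v ≡ u)

  adj⇒cycleAdj : ∀ S u v → Adj G S u v → CycleAdj S u v
  adj⇒cycleAdj S u v (e , Se , inj₁ eq) with trans (sym (lookup-G e)) eq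
  ... | refl = inj₁ (Se , refl)
  adj⇒cycleAdj S u v (e , Se , inj₂ eq) with trans (sym (lookup-G e)) eq
  ... | refl = inj₂ (Se , refl)

  cycleAdj⇒adj : ∀ S u v → CycleAdj S u v → Adj G S u v
  cycleAdj⇒adj S u v (inj₁ (Su , refl)) = u , Su , inj₁ (lookup-G u)
  cycleAdj⇒adj S u v (inj₂ (Sv , refl)) = v , Sv , inj₂ (lookup-G v)

  adj-sym : ∀ S {u v} → Adj G S u v → Adj G S v u
  adj-sym S (e , Se , inj₁ eq) = e , Se , inj₂ eq
  adj-sym S (e , Se , inj₂ eq) = e , Se , inj₁ eq

  Reach : Vec Bool N → Fin N → Fin N → Set
  Reach S u v = ∃ λ k → advance k u ≡ v × (∀ t → t < k → lookup S (advance t u) ≡ true)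

  reach⇒star : ∀ S k u v → advance k u ≡ v → (∀ t → t < k → lookup S (advance t u) ≡ true) → Star (Adj G S) u v
  reach⇒star S zero u v refl _ = ε
  reach⇒star S (suc k) u v eq chosen =
    cycleAdj⇒adj S u (next u) (inj₁ (chosen 0 z<s , refl)) ◅
    reach⇒star S k (next u) v (trans (advance-next k u) eq)
      (λ t t<k → trans (cong (lookup S) (advance-next t u)) (chosen (suc t) (s<s t<k)))

  reach⇒connected : ∀ S u v → Reach S u v ⊎ Reach S v u → Connected G S u v
  reach⇒connected S u v (inj₁ (k , eq , chosen)) = reach⇒star S k u v eq chosen
  reach⇒connected S u v (inj₂ (k , eq , chosen)) = reverse (adj-sym S) (reach⇒star S k v u eq chosen)

  private
    reach-prepend : ∀ S u w v → CycleAdj S u w → Reach S w v ⊎ Reach S v w → Reach S u v ⊎ Reach S v u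
    reach-prepend S u w v (inj₁ (Su , refl)) (inj₁ (k , eq , chosen)) =
      inj₁ (suc k , trans (sym (advance-next k u)) eq ,
            λ { zero _ → Su ; (suc t) (s<s t<k) → trans (cong (lookup S) (sym (advance-next t u))) (chosen t t<k) })
    reach-prepend S u w v (inj₁ (Su , refl)) (inj₂ (zero , eq , _)) = inj₁ (1 , sym eq , λ { zero _ → Su ; (suc t) (s<s ()) })
    reach-prepend S u w v (inj₁ (Su , refl)) (inj₂ (suc k , eq , chosen)) =
      inj₂ (k , next-injective eq , λ t t<k → chosen t (<-trans t<k (n<1+n k)))
    reach-prepend S u w v (inj₂ (Sw , refl)) (inj₁ (zero , refl , _)) = inj₂ (1 , refl , λ { zero _ → Sw ; (suc t) (s<s ()) })
    reach-prepend S u w v (inj₂ (Sw , refl)) (inj₁ (suc k , eq , chosen)) =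
      inj₁ (k , trans (advance-next k w) eq , λ t t<k → trans (cong (lookup S) (advance-next t w)) (chosen (suc t) (s<s t<k)))
    reach-prepend S u w v (inj₂ (Sw , refl)) (inj₂ (k , eq , chosen)) = inj₂ (suc k , cong next eq , chosen′)
      where
      chosen′ : ∀ t → t < suc k → lookup S (advance t v) ≡ true
      chosen′ t (s≤s t≤k) with m≤n⇒m<n∨m≡n t≤k
      ... | inj₁ t<k = chosen t t<k
      ... | inj₂ refl = trans (cong (lookup S) eq) Sw

  connected⇒reach : ∀ S u v → Connected G S u v → Reach S u v ⊎ Reach S v u
  connected⇒reach S u .u ε = inj₁ (0 , refl , λ _ ())
  connected⇒reach S u v (_◅_ {j = w} adj rest) = reach-prepend S u w v (adj⇒cycleAdj S u w adj) (connected⇒reach S w v rest)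

-- Rooted forests of the cycle

UnitStep : ℕ → ℕ → Set
UnitStep x y = y ≡ suc x ⊎ x ≡ suc y

-- An injective walk in ℕ with unit steps is monotone, so it cannot close up into a cycle.
module _ (p : ℕ → ℕ) (k : ℕ) (2≤k : 2 ≤ k) (steps : ∀ t → t < k → UnitStep (p t) (p (suc t)))
         (injective : ∀ a b → a ≤ k → b ≤ k → p a ≡ p b → a ≡ b) where

  private
    ss≢ : ∀ t → suc (suc t) ≢ t
    ss≢ t eq = <-irrefl (sym eq) (<-trans (n<1+n t) (n<1+n (suc t)))

    ascending : p 1 ≡ suc (p 0) → ∀ t → suc t ≤ k → p (suc t) ≡ suc (p t)
    ascending h zero _ = h
    ascending h (suc t) le with steps (suc t) le
    ... | inj₁ up = up
    ... | inj₂ down = ⊥-elim (ss≢ t (injective _ _ le (≤-trans (n≤1+n t) (≤-trans (n≤1+n (suc t)) le))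
                        (suc-injective (trans (sym down) (ascending h t (≤-trans (n≤1+n (suc t)) le))))))

    descending : p 0 ≡ suc (p 1) → ∀ t → suc t ≤ k → p t ≡ suc (p (suc t))
    descending h zero _ = h
    descending h (suc t) le with steps (suc t) le
    ... | inj₂ down = down
    ... | inj₁ up = ⊥-elim (ss≢ t (injective _ _ le (≤-trans (n≤1+n t) (≤-trans (n≤1+n (suc t)) le))
                      (trans up (sym (descending h t (≤-trans (n≤1+n (suc t)) le))))))

    ascending-value : p 1 ≡ suc (p 0) → ∀ t → t ≤ k → p t ≡ t + p 0
    ascending-value h zero _ = refl
    ascending-value h (suc t) le = trans (ascending h t le) (cong suc (ascending-value h t (≤-trans (n≤1+n t) le)))

    descending-value : p 0 ≡ suc (p 1) → ∀ t → t ≤ k → p 0 ≡ t + p t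
    descending-value h zero _ = refl
    descending-value h (suc t) le = trans (descending-value h t (≤-trans (n≤1+n t) le))
                                          (trans (cong (t +_) (descending h t le)) (+-suc t (p (suc t))))

    k≢1 : k ≢ 1
    k≢1 eq = <-irrefl refl (≤-trans 2≤k (≤-reflexive eq))

  unit-walk-not-closed : ¬ UnitStep (p 0) (p k)
  unit-walk-not-closed closing with steps 0 (≤-trans (s≤s z≤n) 2≤k)
  unit-walk-not-closed (inj₁ c) | inj₁ h = k≢1 (+-cancelʳ-≡ (p 0) k 1 (trans (sym (ascending-value h k ≤-refl)) c))
  unit-walk-not-closed (inj₂ c) | inj₁ h = <-irrefl (trans c (cong suc (ascending-value h k ≤-refl)))
                                             (≤-<-trans (m≤n+m (p 0) k) (n<1+n (k + p 0)))
  unit-walk-not-closed (inj₁ c) | inj₂ h = <-irrefl (trans (descending-value h k ≤-refl) (cong (k +_) c))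
                                             (≤-<-trans (m≤n+m (p 0) k) (≤-reflexive (sym (+-suc k (p 0)))))
  unit-walk-not-closed (inj₂ c) | inj₂ h = k≢1 (+-cancelʳ-≡ (p k) k 1 (trans (sym (descending-value h k ≤-refl)) c))

HasGap : ∀ {n} → Vec Bool n → Set
HasGap S = ∃ λ v → lookup S v ≡ false

all-chosen⊎gap : ∀ {n} (S : Vec Bool n) → (∀ v → lookup S v ≡ true) ⊎ HasGap S
all-chosen⊎gap {n} S with all? (λ v → lookup S v ≟ᵇ true)
... | yes all = inj₁ all
... | no ¬all with ¬∀⟶∃¬ n _ (λ v → lookup S v ≟ᵇ true) ¬all
... | v , Sv≢true = inj₂ (v , ¬-not Sv≢true)

step-gap : ∀ q r → step q (r , false) ≡ unrooted ⊎ step q (r , false) ≡ dead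
step-gap unrooted false = inj₂ refl
step-gap unrooted true = inj₁ refl
step-gap rooted false = inj₁ refl
step-gap rooted true = inj₂ refl
step-gap dead _ = inj₂ refl

module ForestsOnCycle (m : ℕ) where
  open CycleOn m

  cycleLabel : Configuration N → ℕ → Label
  cycleLabel (S , R) t = (lookup R (advance t zero) , lookup S (advance t zero))

  ReturnsTo : Configuration N → State → Set
  ReturnsTo x q = run free (cycleLabel x) q N ≡ q

  cycleLabel-periodic : ∀ x t → cycleLabel x (N + t) ≡ cycleLabel x t
  cycleLabel-periodic (S , R) t = cong (λ v → (lookup R v , lookup S v)) (trans (advance-+ N t zero) (advance-N _))

  module CutAt (S R : Vec Bool N) (e : ℕ) (e<N : e < N) (gap : lookup S (advance e zero) ≡ false) where

    x : Configuration N
    x = (S , R)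

    -- positions are counted from the vertex following the missing edge e
    start : Fin N
    start = advance (suc e) zero

    vertexAt : ℕ → Fin N
    vertexAt p = advance p start

    root edge : ℕ → Bool
    root p = lookup R (vertexAt p)
    edge p = lookup S (vertexAt p)

    open PathForest root edge public using (state; path-forest⇒; path-forest⇐; Covered; RootsApart)

    shifted : ℕ → Label
    shifted p = cycleLabel x (suc e + p)

    pathRun : State
    pathRun = run free shifted unrooted N

    pathRun≡state : pathRun ≡ state N
    pathRun≡state = run-cong free shifted (PathForest.labelsOf root edge) unrooted N
                      (λ t _ → cong (λ v → (lookup R v , lookup S v)) shift)
      where
      shift : ∀ {t} → advance (suc e + t) zero ≡ vertexAt t
      shift {t} = trans (cong (λ k → advance k zero) (+-comm (suc e) t)) (advance-+ t (suc e) zero)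

    throughGap : State → State
    throughGap q = run free (cycleLabel x) q (suc e)

    -- the missing edge e closes a tree, so past it the start state is forgotten
    throughGap-cases : ∀ q → throughGap q ≡ unrooted ⊎ throughGap q ≡ dead
    throughGap-cases q = subst (λ q′ → q′ ≡ unrooted ⊎ q′ ≡ dead) (sym throughGap≡)
                           (step-gap (run free (cycleLabel x) q e) (lookup R (advance e zero)))
      where
      throughGap≡ : throughGap q ≡ step (run free (cycleLabel x) q e) (lookup R (advance e zero) , false)
      throughGap≡ = trans (run-suc free (cycleLabel x) q e)
                      (trans (stepᶜ-sat (run free (cycleLabel x) q e) refl)
                             (cong (λ s → step (run free (cycleLabel x) q e) (lookup R (advance e zero) , s)) gap))

    K : ℕ
    K = N ∸ suc e

    afterGap : State
    afterGap = run free shifted unrooted K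

    e+K≡N : suc e + K ≡ N
    e+K≡N = m+[n∸m]≡n e<N

    around-split : ∀ q → run free (cycleLabel x) q N ≡ run free shifted (throughGap q) K
    around-split q = trans (cong (run free (cycleLabel x) q) (sym e+K≡N)) (run-+ free (cycleLabel x) q (suc e) K)

    pathRun-split : pathRun ≡ throughGap afterGap
    pathRun-split = trans (cong (run free shifted unrooted) (sym K+e≡N))
      (trans (run-+ free shifted unrooted K (suc e))
             (run-cong free (shifted ∘ (K +_)) (cycleLabel x) afterGap (suc e)
               (λ t _ → trans (cong (cycleLabel x) (trans (sym (+-assoc (suc e) K t)) (cong (_+ t) e+K≡N)))
                              (cycleLabel-periodic x t))))
      where
      K+e≡N : K + suc e ≡ N
      K+e≡N = trans (+-comm K (suc e)) e+K≡N

    dead-after-gap : ∀ q → throughGap q ≡ dead → run free (cycleLabel x) q N ≡ dead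
    dead-after-gap q dies = trans (around-split q) (trans (cong (λ w → run free shifted w K) dies) (run-dead free shifted K))

    returns⇒path : ∀ q → ReturnsTo x q → q ≢ dead → pathRun ≡ unrooted
    returns⇒path q returns alive with throughGap-cases q
    ... | inj₂ dies = ⊥-elim (alive (trans (sym returns) (dead-after-gap q dies)))
    ... | inj₁ passes = trans pathRun-split (trans (cong throughGap afterGap≡q) passes)
      where
      afterGap≡q : afterGap ≡ q
      afterGap≡q = trans (cong (λ w → run free shifted w K) (sym passes)) (trans (sym (around-split q)) returns)

    path⇒returns : pathRun ≡ unrooted → ReturnsTo x afterGap × afterGap ≢ dead
    path⇒returns final = trans (around-split afterGap) (cong (λ w → run free shifted w K) passes) , alive
      where
      passes : throughGap afterGap ≡ unrooted
      passes = trans (sym pathRun-split) final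
      alive : afterGap ≢ dead
      alive dies with trans (sym passes) (trans (cong throughGap dies) (run-dead free (cycleLabel x) (suc e)))
      ... | ()

    returns-unique : ReturnsTo x unrooted → ReturnsTo x rooted → ⊥
    returns-unique from-u from-r with throughGap-cases unrooted | throughGap-cases rooted
    ... | inj₂ dies | _ with trans (sym from-u) (dead-after-gap unrooted dies)
    ... | ()
    returns-unique from-u from-r | inj₁ _ | inj₂ dies with trans (sym from-r) (dead-after-gap rooted dies)
    ... | ()
    returns-unique from-u from-r | inj₁ passes-u | inj₁ passes-r
      with trans (sym from-u) (trans (around-split unrooted)
             (trans (cong (λ w → run free shifted w K) (trans passes-u (sym passes-r))) (trans (sym (around-split rooted)) from-r)))
    ... | ()

    advance-vertexAt : ∀ t a → advance t (vertexAt a) ≡ vertexAt (t + a)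
    advance-vertexAt t a = sym (advance-+ t a _)

    vertexAt-last : vertexAt m ≡ advance e zero
    vertexAt-last = begin
      advance m (advance (suc e) zero) ≡⟨ sym (advance-+ m (suc e) zero) ⟩
      advance (m + suc e) zero         ≡⟨ cong (λ k → advance k zero) (+-suc m e) ⟩
      advance (N + e) zero             ≡⟨ advance-+ N e zero ⟩
      advance N (advance e zero)       ≡⟨ advance-N _ ⟩
      advance e zero                   ∎

    edge-last : edge m ≡ false
    edge-last = trans (cong (lookup S) vertexAt-last) gap

    vertexAt-injective : ∀ {a b} → a < N → b < N → vertexAt a ≡ vertexAt b → a ≡ b
    vertexAt-injective = advance-injectiveˡ _

    reach⇒linked : ∀ a b → a < N → b < N → Reach S (vertexAt a) (vertexAt b) → a ≤ b × Linked edge a b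
    reach⇒linked a b a<N b<N (k , eq , chosen) = subst (a ≤_) k+a≡b (m≤n+m a k) , linked
      where
      k+a≤m : k + a ≤ m
      k+a≤m with k + a ≤? m
      ... | yes le = le
      ... | no k+a≰m with trans (sym (chosen (m ∸ a) m∸a<k))
                            (trans (cong (lookup S) (trans (advance-vertexAt (m ∸ a) a) (cong vertexAt (m∸n+n≡m (<⇒≤pred a<N)))))
                                   edge-last)
        where
        m∸a<k : m ∸ a < k
        m∸a<k = +-cancelʳ-< a (m ∸ a) k (subst (_< k + a) (sym (m∸n+n≡m (<⇒≤pred a<N))) (≰⇒> k+a≰m))
      ... | ()
      k+a≡b : k + a ≡ b
      k+a≡b = vertexAt-injective (s≤s k+a≤m) b<N (trans (sym (advance-vertexAt k a)) eq)
      linked : Linked edge a b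
      linked t a≤t t<b = trans (cong (lookup S) (trans (cong vertexAt (sym (m∸n+n≡m a≤t))) (sym (advance-vertexAt (t ∸ a) a))))
        (chosen (t ∸ a) (+-cancelʳ-< a (t ∸ a) k (subst₂ _<_ (sym (m∸n+n≡m a≤t)) (sym k+a≡b) t<b)))

    linked⇒reach : ∀ a b → a ≤ b → Linked edge a b → Reach S (vertexAt a) (vertexAt b)
    linked⇒reach a b a≤b linked = b ∸ a , trans (advance-vertexAt (b ∸ a) a) (cong vertexAt (m∸n+n≡m a≤b)) ,
      λ t t<b∸a → trans (cong (lookup S) (advance-vertexAt t a))
                        (linked (t + a) (m≤n+m a t) (subst (t + a <_) (m∸n+n≡m a≤b) (+-monoˡ-< a t<b∸a)))

    connected⇒joined : ∀ a b → a < N → b < N → Connected G S (vertexAt a) (vertexAt b) → Joined edge a b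
    connected⇒joined a b a<N b<N c with connected⇒reach S (vertexAt a) (vertexAt b) c
    ... | inj₁ ab = inj₁ (reach⇒linked a b a<N b<N ab)
    ... | inj₂ ba = inj₂ (reach⇒linked b a b<N a<N ba)

    joined⇒connected : ∀ a b → Joined edge a b → Connected G S (vertexAt a) (vertexAt b)
    joined⇒connected a b (inj₁ (a≤b , ab)) = reach⇒connected S (vertexAt a) (vertexAt b) (inj₁ (linked⇒reach a b a≤b ab))
    joined⇒connected a b (inj₂ (b≤a , ba)) = reach⇒connected S (vertexAt a) (vertexAt b) (inj₂ (linked⇒reach b a b≤a ba))

    position : Fin N → ℕ
    position u = proj₁ (advance-surjective start u)

    position<N : ∀ u → position u < N
    position<N u = proj₁ (proj₂ (advance-surjective start u))

    vertexAt-position : ∀ u → vertexAt (position u) ≡ u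
    vertexAt-position u = proj₂ (proj₂ (advance-surjective start u))

    position-injective : ∀ {u v} → position u ≡ position v → u ≡ v
    position-injective {u} {v} eq = trans (sym (vertexAt-position u)) (trans (cong vertexAt eq) (vertexAt-position v))

    EveryVertexRooted : Set
    EveryVertexRooted = (v : Fin N) → ∃ λ r → lookup R r ≡ true × Connected G S v r

    OneRootPerTree : Set
    OneRootPerTree = (r r′ : Fin N) → lookup R r ≡ true → lookup R r′ ≡ true → Connected G S r r′ → r ≡ r′

    rooted⇒covered : EveryVertexRooted → Covered N
    rooted⇒covered every a a<N with every (vertexAt a)
    ... | (ρ , Rρ , c) = position ρ , position<N ρ , trans (cong (lookup R) (vertexAt-position ρ)) Rρ ,
          connected⇒joined a (position ρ) a<N (position<N ρ) (subst (Connected G S (vertexAt a)) (sym (vertexAt-position ρ)) c)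

    covered⇒rooted : Covered N → EveryVertexRooted
    covered⇒rooted covered v with covered (position v) (position<N v)
    ... | (b , _ , Rb , j) = vertexAt b , Rb , subst (λ w → Connected G S w (vertexAt b)) (vertexAt-position v)
                                                      (joined⇒connected (position v) b j)

    oneRoot⇒apart : OneRootPerTree → RootsApart N
    oneRoot⇒apart one a b a<b b<N Ra Rb ab =
      <-irrefl (vertexAt-injective (<-trans a<b b<N) b<N (one (vertexAt a) (vertexAt b) Ra Rb
                 (joined⇒connected a b (inj₁ (<⇒≤ a<b , ab))))) a<b

    apart⇒oneRoot : RootsApart N → OneRootPerTree
    apart⇒oneRoot apart ρ ρ′ Rρ Rρ′ c = position-injective same
      where
      a = position ρ
      b = position ρ′
      Ra : root a ≡ true
      Ra = trans (cong (lookup R) (vertexAt-position ρ)) Rρ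
      Rb : root b ≡ true
      Rb = trans (cong (lookup R) (vertexAt-position ρ′)) Rρ′
      same : a ≡ b
      same with connected⇒joined a b (position<N ρ) (position<N ρ′)
                  (subst₂ (Connected G S) (sym (vertexAt-position ρ)) (sym (vertexAt-position ρ′)) c)
      ... | inj₁ (a≤b , ab) with m≤n⇒m<n∨m≡n a≤b
      ... | inj₁ a<b = ⊥-elim (apart a b a<b (position<N ρ′) Ra Rb ab)
      ... | inj₂ a≡b = a≡b
      same | inj₂ (b≤a , ba) with m≤n⇒m<n∨m≡n b≤a
      ... | inj₁ b<a = ⊥-elim (apart b a b<a (position<N ρ) Rb Ra ba)
      ... | inj₂ b≡a = sym b≡a

    position-next : ∀ u → lookup S u ≡ true → position (next u) ≡ suc (position u)
    position-next u Su = vertexAt-injective (position<N (next u)) sa<N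
                           (trans (vertexAt-position (next u)) (cong next (sym (vertexAt-position u))))
      where
      a = position u
      a≢m : a ≢ m
      a≢m a≡m with trans (sym Su) (trans (cong (lookup S) (sym (vertexAt-position u))) (trans (cong edge a≡m) edge-last))
      ... | ()
      sa<N : suc a < N
      sa<N = s≤s (≤∧≢⇒< (<⇒≤pred (position<N u)) a≢m)

    adj⇒unitStep : ∀ u v → Adj G S u v → UnitStep (position u) (position v)
    adj⇒unitStep u v adj with adj⇒cycleAdj S u v adj
    ... | inj₁ (Su , refl) = inj₁ (position-next u Su)
    ... | inj₂ (Sv , refl) = inj₂ (position-next v Sv)

    acyclic : Acyclic G S
    acyclic (k , 2≤k , vs , vs-injective , steps , closing) =
      unit-walk-not-closed p k 2≤k unit-steps p-injective (swap (adj⇒unitStep _ _ (subst₂ (Adj G S) last first closing)))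
      where
      index : ℕ → Fin (suc k)
      index t = t mod suc k
      toℕ-index : ∀ t → t ≤ k → toℕ (index t) ≡ t
      toℕ-index t t≤k = trans (toℕ-fromℕ< _) (m≤n⇒m%n≡m t≤k)
      index-toℕ : ∀ i → index (toℕ i) ≡ i
      index-toℕ i = toℕ-injective (toℕ-index (toℕ i) (<⇒≤pred (toℕ<n i)))
      p : ℕ → ℕ
      p t = position (vs (index t))
      unit-steps : ∀ t → t < k → UnitStep (p t) (p (suc t))
      unit-steps t t<k = adj⇒unitStep _ _ (subst₂ (Adj G S) (cong vs this) (cong vs following) (steps i))
        where
        i = fromℕ< t<k
        this : inject₁ i ≡ index t
        this = trans (sym (index-toℕ (inject₁ i))) (cong index (trans (toℕ-inject₁ i) (toℕ-fromℕ< t<k)))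
        following : suc i ≡ index (suc t)
        following = trans (sym (index-toℕ (suc i))) (cong index (cong suc (toℕ-fromℕ< t<k)))
      p-injective : ∀ a b → a ≤ k → b ≤ k → p a ≡ p b → a ≡ b
      p-injective a b a≤k b≤k eq =
        trans (sym (toℕ-index a a≤k)) (trans (cong toℕ (vs-injective (position-injective eq))) (toℕ-index b b≤k))
      last : vs (fromℕ k) ≡ vs (index k)
      last = cong vs (trans (sym (index-toℕ (fromℕ k))) (cong index (toℕ-fromℕ k)))
      first : vs zero ≡ vs (index 0)
      first = cong vs (sym (index-toℕ zero))

  all-chosen⇒cycle : ∀ S → 2 ≤ m → (∀ v → lookup S v ≡ true) → HasCycle G S
  all-chosen⇒cycle S 2≤m all = m , 2≤m , (λ i → i) , (λ eq → eq) ,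
      (λ i → cycleAdj⇒adj S _ _ (inj₁ (all _ , next-inject₁ i))) ,
      cycleAdj⇒adj S _ _ (inj₁ (all _ , next-last (fromℕ m) (cong suc (toℕ-fromℕ m))))
    where
    next-inject₁ : ∀ (i : Fin m) → next (inject₁ i) ≡ suc i
    next-inject₁ i = toℕ-injective (trans (toℕ-next (inject₁ i) (s≤s (subst (_< m) (sym (toℕ-inject₁ i)) (toℕ<n i))))
                                          (cong suc (toℕ-inject₁ i)))

  module CutAtGap (S R : Vec Bool N) (g : HasGap S) =
    CutAt S R (toℕ (proj₁ g)) (toℕ<n (proj₁ g)) (trans (cong (lookup S) (advance-toℕ (proj₁ g))) (proj₂ g))

  ReturnsSomewhere : Configuration N → Set
  ReturnsSomewhere x = ReturnsTo x unrooted ⊎ ReturnsTo x rooted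

  rootedForest⇒returns : ∀ S R → 2 ≤ m → RootedForest G (S , R) → HasGap S × ReturnsSomewhere (S , R)
  rootedForest⇒returns S R 2≤m (acyclic , every , one) with all-chosen⊎gap S
  ... | inj₁ all = ⊥-elim (acyclic (all-chosen⇒cycle S 2≤m all))
  ... | inj₂ g = g , returns
    where
    open CutAtGap S R g
    returns : ReturnsSomewhere (S , R)
    returns with path⇒returns (trans pathRun≡state (path-forest⇐ m edge-last (rooted⇒covered every) (oneRoot⇒apart one)))
    ... | (ret , alive) with afterGap
    ... | unrooted = inj₁ ret
    ... | rooted = inj₂ ret
    ... | dead = ⊥-elim (alive refl)

  returns⇒rootedForest : ∀ S R → HasGap S → ReturnsSomewhere (S , R) → RootedForest G (S , R)
  returns⇒rootedForest S R g returns = acyclic , covered⇒rooted (proj₁ path) , apart⇒oneRoot (proj₂ path)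
    where
    open CutAtGap S R g
    final : pathRun ≡ unrooted
    final = [ (λ ret → returns⇒path unrooted ret (λ ())) , (λ ret → returns⇒path rooted ret (λ ())) ]′ returns
    path = path-forest⇒ m edge-last (trans (sym pathRun≡state) final)

  returns-exclusive : ∀ S R → HasGap S → ReturnsTo (S , R) unrooted → ReturnsTo (S , R) rooted → ⊥
  returns-exclusive S R g = CutAtGap.returns-unique S R g

-- Traces of transfer-matrix products

Free Edge Root RootEdge : Mat
Free = transfer (false , false)
Edge = transfer (false , true)
Root = transfer (true , false)
RootEdge = transfer (true , true)

-- F(2k - 1), reading F(-1) as 1
fib-double-pred : ℕ → ℕ
fib-double-pred zero = 1
fib-double-pred (suc k) = fib (suc (double k))

fib-double-pred-+ : ∀ k → fib-double-pred k + fib (double k) ≡ fib (suc (double k))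
fib-double-pred-+ zero = refl
fib-double-pred-+ (suc k) = +-comm (fib (suc (double k))) (fib (suc (suc (double k))))

Free-^ : ∀ k → Free ^ᴹ k ≡ mk (fib (suc (double k))) (fib (double k)) (fib (double k)) (fib-double-pred k)
Free-^ zero = refl
Free-^ (suc k) = trans (cong (Free ⊗_) (Free-^ k))
                       (mk-cong (e₁ a b) (trans (e₂ b d) (cong (_+ b) d+b≡a)) (e₃ a b) (trans (e₄ b d) d+b≡a))
  where
  a = fib (suc (double k))
  b = fib (double k)
  d = fib-double-pred k
  d+b≡a : d + b ≡ a
  d+b≡a = fib-double-pred-+ k
  e₁ : ∀ a b → 2 * a + 1 * b ≡ (a + b) + a
  e₁ = solve-∀
  e₂ : ∀ b d → 2 * b + 1 * d ≡ (d + b) + b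
  e₂ = solve-∀
  e₃ : ∀ a b → 1 * a + 1 * b ≡ a + b
  e₃ = solve-∀
  e₄ : ∀ b d → 1 * b + 1 * d ≡ d + b
  e₄ = solve-∀

Edge-^ : ∀ k → Edge ^ᴹ k ≡ mk 1 k 0 1
Edge-^ zero = refl
Edge-^ (suc k) = trans (cong (Edge ⊗_) (Edge-^ k)) (mk-cong refl (e k) refl refl)
  where
  e : ∀ k → 1 * k + 1 * 1 ≡ suc k
  e = solve-∀

RootEdge-absorbs-Edge : ∀ k → RootEdge ⊗ Edge ^ᴹ k ≡ RootEdge
RootEdge-absorbs-Edge zero = refl
RootEdge-absorbs-Edge (suc k) = trans (sym (⊗-assoc RootEdge Edge (Edge ^ᴹ k))) (RootEdge-absorbs-Edge k)

Edge-absorbed-by-Root : ∀ k → Edge ^ᴹ k ⊗ Root ≡ Root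
Edge-absorbed-by-Root zero = refl
Edge-absorbed-by-Root (suc k) = trans (⊗-assoc Edge (Edge ^ᴹ k) Root) (cong (Edge ⊗_) (Edge-absorbed-by-Root k))

trace-Free-^ : ∀ m → trace (Free ^ᴹ suc m) ≡ lucas (double (suc m))
trace-Free-^ m = trans (cong trace (Free-^ (suc m))) (sym (lucas-double-suc m))

trace-Edge-^ : ∀ k → trace (Edge ^ᴹ k) ≡ 2
trace-Edge-^ k = cong trace (Edge-^ k)

trace-RootEdge-Free : ∀ k → trace (RootEdge ⊗ Free ^ᴹ k) ≡ fib (double k)
trace-RootEdge-Free k = trans (trace-RootEdge X) (cong (λ X → entry X rooted unrooted) (Free-^ k))
  where
  X = Free ^ᴹ k
  trace-RootEdge : ∀ X → trace (RootEdge ⊗ X) ≡ entry X rooted unrooted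
  trace-RootEdge (mk a b c d) = e a b c d
    where
    e : ∀ a b c d → (0 * a + 1 * c) + (0 * b + 0 * d) ≡ c
    e = solve-∀

trace-Root-Free : ∀ k → trace (Root ⊗ Free ^ᴹ k) ≡ fib (double (suc k))
trace-Root-Free k = trans (trace-Root X) (cong (λ X → entry X unrooted unrooted + entry X rooted unrooted) (Free-^ k))
  where
  X = Free ^ᴹ k
  trace-Root : ∀ X → trace (Root ⊗ X) ≡ entry X unrooted unrooted + entry X rooted unrooted
  trace-Root (mk a b c d) = e a b c d
    where
    e : ∀ a b c d → (1 * a + 1 * c) + (0 * b + 0 * d) ≡ a + c
    e = solve-∀

transferProduct-+ : ∀ cs k l → transferProduct cs (k + l) ≡ transferProduct cs k ⊗ transferProduct (cs ∘ (k +_)) l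
transferProduct-+ cs zero l = sym (⊗-identityˡ _)
transferProduct-+ cs (suc k) l = trans (cong (transfer (cs 0) ⊗_) (transferProduct-+ (cs ∘ suc) k l))
                                       (sym (⊗-assoc (transfer (cs 0)) _ _))

transferProduct-const : ∀ cs k c → (∀ p → p < k → cs p ≡ c) → transferProduct cs k ≡ transfer c ^ᴹ k
transferProduct-const cs zero c _ = refl
transferProduct-const cs (suc k) c const =
  cong₂ _⊗_ (cong transfer (const 0 z<s)) (transferProduct-const (cs ∘ suc) k c (λ p p<k → const (suc p) (s<s p<k)))

transferProduct-blocks : ∀ cs k₁ k₂ k₃ k₄ c₁ c₂ c₃ c₄ →
  (∀ p → p < k₁ → cs p ≡ c₁) → (∀ p → p < k₂ → cs (k₁ + p) ≡ c₂) →
  (∀ p → p < k₃ → cs (k₁ + (k₂ + p)) ≡ c₃) → (∀ p → p < k₄ → cs (k₁ + (k₂ + (k₃ + p))) ≡ c₄) →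
  transferProduct cs (k₁ + (k₂ + (k₃ + k₄))) ≡
    transfer c₁ ^ᴹ k₁ ⊗ (transfer c₂ ^ᴹ k₂ ⊗ (transfer c₃ ^ᴹ k₃ ⊗ transfer c₄ ^ᴹ k₄))
transferProduct-blocks cs k₁ k₂ k₃ k₄ c₁ c₂ c₃ c₄ b₁ b₂ b₃ b₄ = begin
  transferProduct cs (k₁ + (k₂ + (k₃ + k₄)))
    ≡⟨ transferProduct-+ cs k₁ _ ⟩
  transferProduct cs k₁ ⊗ transferProduct cs₂ (k₂ + (k₃ + k₄))
    ≡⟨ cong (transferProduct cs k₁ ⊗_) (transferProduct-+ cs₂ k₂ _) ⟩
  transferProduct cs k₁ ⊗ (transferProduct cs₂ k₂ ⊗ transferProduct cs₃ (k₃ + k₄))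
    ≡⟨ cong (λ X → transferProduct cs k₁ ⊗ (transferProduct cs₂ k₂ ⊗ X)) (transferProduct-+ cs₃ k₃ k₄) ⟩
  transferProduct cs k₁ ⊗ (transferProduct cs₂ k₂ ⊗ (transferProduct cs₃ k₃ ⊗ transferProduct (cs₃ ∘ (k₃ +_)) k₄))
    ≡⟨ cong₂ _⊗_ (transferProduct-const cs k₁ c₁ b₁)
         (cong₂ _⊗_ (transferProduct-const cs₂ k₂ c₂ b₂)
           (cong₂ _⊗_ (transferProduct-const cs₃ k₃ c₃ b₃) (transferProduct-const _ k₄ c₄ b₄))) ⟩
  transfer c₁ ^ᴹ k₁ ⊗ (transfer c₂ ^ᴹ k₂ ⊗ (transfer c₃ ^ᴹ k₃ ⊗ transfer c₄ ^ᴹ k₄)) ∎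
  where
  cs₂ = cs ∘ (k₁ +_)
  cs₃ = cs₂ ∘ (k₂ +_)

^ᴹ-1 : ∀ A → A ^ᴹ 1 ≡ A
^ᴹ-1 = ⊗-identityʳ

trace-F-RE-E-F : ∀ a c d → trace (Free ^ᴹ a ⊗ (RootEdge ^ᴹ 1 ⊗ (Edge ^ᴹ c ⊗ Free ^ᴹ d))) ≡ fib (double (d + a))
trace-F-RE-E-F a c d = begin
  trace (Free ^ᴹ a ⊗ (RootEdge ^ᴹ 1 ⊗ (Edge ^ᴹ c ⊗ Free ^ᴹ d)))
    ≡⟨ trace-rotate (Free ^ᴹ a) (RootEdge ^ᴹ 1) _ ⟩
  trace (RootEdge ^ᴹ 1 ⊗ ((Edge ^ᴹ c ⊗ Free ^ᴹ d) ⊗ Free ^ᴹ a))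
    ≡⟨ cong₂ (λ X Y → trace (X ⊗ Y)) (^ᴹ-1 RootEdge)
             (trans (⊗-assoc (Edge ^ᴹ c) _ _) (cong (Edge ^ᴹ c ⊗_) (sym (^ᴹ-+ Free d a)))) ⟩
  trace (RootEdge ⊗ (Edge ^ᴹ c ⊗ Free ^ᴹ (d + a)))
    ≡⟨ cong trace (sym (⊗-assoc RootEdge (Edge ^ᴹ c) _)) ⟩
  trace (RootEdge ⊗ Edge ^ᴹ c ⊗ Free ^ᴹ (d + a))
    ≡⟨ cong (λ X → trace (X ⊗ Free ^ᴹ (d + a))) (RootEdge-absorbs-Edge c) ⟩
  trace (RootEdge ⊗ Free ^ᴹ (d + a))
    ≡⟨ trace-RootEdge-Free (d + a) ⟩
  fib (double (d + a)) ∎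

trace-E-R-F-E : ∀ a c d → trace (Edge ^ᴹ a ⊗ (Root ^ᴹ 1 ⊗ (Free ^ᴹ c ⊗ Edge ^ᴹ d))) ≡ fib (double (suc c))
trace-E-R-F-E a c d = begin
  trace (Edge ^ᴹ a ⊗ (Root ^ᴹ 1 ⊗ (Free ^ᴹ c ⊗ Edge ^ᴹ d)))
    ≡⟨ cong (λ X → trace (Edge ^ᴹ a ⊗ (X ⊗ (Free ^ᴹ c ⊗ Edge ^ᴹ d)))) (^ᴹ-1 Root) ⟩
  trace (Edge ^ᴹ a ⊗ (Root ⊗ (Free ^ᴹ c ⊗ Edge ^ᴹ d)))
    ≡⟨ trace-rotate (Edge ^ᴹ a) Root _ ⟩
  trace (Root ⊗ ((Free ^ᴹ c ⊗ Edge ^ᴹ d) ⊗ Edge ^ᴹ a))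
    ≡⟨ cong (λ X → trace (Root ⊗ X)) (trans (⊗-assoc (Free ^ᴹ c) _ _) (cong (Free ^ᴹ c ⊗_) (sym (^ᴹ-+ Edge d a)))) ⟩
  trace (Root ⊗ (Free ^ᴹ c ⊗ Edge ^ᴹ (d + a)))
    ≡⟨ trace-rotate Root (Free ^ᴹ c) _ ⟩
  trace (Free ^ᴹ c ⊗ (Edge ^ᴹ (d + a) ⊗ Root))
    ≡⟨ cong (λ X → trace (Free ^ᴹ c ⊗ X)) (Edge-absorbed-by-Root (d + a)) ⟩
  trace (Free ^ᴹ c ⊗ Root)
    ≡⟨ trace-comm (Free ^ᴹ c) Root ⟩
  trace (Root ⊗ Free ^ᴹ c)
    ≡⟨ trace-Root-Free c ⟩
  fib (double (suc c)) ∎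

trace-E-F-RE-E : ∀ b c d → trace (Edge ^ᴹ b ⊗ (Free ^ᴹ c ⊗ (RootEdge ^ᴹ 1 ⊗ Edge ^ᴹ d))) ≡ fib (double c)
trace-E-F-RE-E b c d = begin
  trace (Edge ^ᴹ b ⊗ (Free ^ᴹ c ⊗ (RootEdge ^ᴹ 1 ⊗ Edge ^ᴹ d)))
    ≡⟨ cong (λ X → trace (Edge ^ᴹ b ⊗ (Free ^ᴹ c ⊗ X)))
            (trans (cong (_⊗ Edge ^ᴹ d) (^ᴹ-1 RootEdge)) (RootEdge-absorbs-Edge d)) ⟩
  trace (Edge ^ᴹ b ⊗ (Free ^ᴹ c ⊗ RootEdge))
    ≡⟨ trace-rotate (Edge ^ᴹ b) (Free ^ᴹ c) RootEdge ⟩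
  trace (Free ^ᴹ c ⊗ (RootEdge ⊗ Edge ^ᴹ b))
    ≡⟨ cong (λ X → trace (Free ^ᴹ c ⊗ X)) (RootEdge-absorbs-Edge b) ⟩
  trace (Free ^ᴹ c ⊗ RootEdge)
    ≡⟨ trace-comm (Free ^ᴹ c) RootEdge ⟩
  trace (RootEdge ⊗ Free ^ᴹ c)
    ≡⟨ trace-RootEdge-Free c ⟩
  fib (double c) ∎

trace-F-E-R-F : ∀ b c d → trace (Free ^ᴹ b ⊗ (Edge ^ᴹ c ⊗ (Root ^ᴹ 1 ⊗ Free ^ᴹ d))) ≡ fib (double (suc (d + b)))
trace-F-E-R-F b c d = begin
  trace (Free ^ᴹ b ⊗ (Edge ^ᴹ c ⊗ (Root ^ᴹ 1 ⊗ Free ^ᴹ d)))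
    ≡⟨ cong (λ X → trace (Free ^ᴹ b ⊗ X))
         (trans (sym (⊗-assoc (Edge ^ᴹ c) _ _))
                (cong (_⊗ Free ^ᴹ d) (trans (cong (Edge ^ᴹ c ⊗_) (^ᴹ-1 Root)) (Edge-absorbed-by-Root c)))) ⟩
  trace (Free ^ᴹ b ⊗ (Root ⊗ Free ^ᴹ d))
    ≡⟨ trace-rotate (Free ^ᴹ b) Root (Free ^ᴹ d) ⟩
  trace (Root ⊗ (Free ^ᴹ d ⊗ Free ^ᴹ b))
    ≡⟨ cong (λ X → trace (Root ⊗ X)) (sym (^ᴹ-+ Free d b)) ⟩
  trace (Root ⊗ Free ^ᴹ (d + b))
    ≡⟨ trace-Root-Free (d + b) ⟩
  fib (double (suc (d + b))) ∎

lookup≡at : ∀ {n} (v : Vec Bool n) i → lookup v i ≡ at v (toℕ i)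
lookup≡at (b ∷ v) zero = refl
lookup≡at (b ∷ v) (suc i) = lookup≡at v i

sat-intro : ∀ c l → (proj₁ c ≡ true → proj₁ l ≡ true) → (proj₂ c ≡ true → proj₂ l ≡ true) → sat c l ≡ true
sat-intro (false , false) _ _ _ = refl
sat-intro (false , true) (r , s) _ s≡ rewrite s≡ refl = refl
sat-intro (true , false) (r , s) r≡ _ rewrite r≡ refl = refl
sat-intro (true , true) (r , s) r≡ s≡ rewrite r≡ refl | s≡ refl = refl

sat-root : ∀ c l → sat c l ≡ true → proj₁ c ≡ true → proj₁ l ≡ true
sat-root (true , _) (true , _) _ _ = refl

sat-edge : ∀ c l → sat c l ≡ true → proj₂ c ≡ true → proj₂ l ≡ true
sat-edge (false , true) (_ , true) _ _ = refl
sat-edge (true , true) (true , true) _ _ = refl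

does-true⇒ : ∀ {A : Set} (d : Dec A) → does d ≡ true → A
does-true⇒ (yes a) _ = a

-- p lies on the clockwise arc of positions from x (inclusive) to y (exclusive)
InArc : ℕ → ℕ → ℕ → Set
InArc x y p = (x ≤ y × x ≤ p × p < y) ⊎ (y < x × (x ≤ p ⊎ p < y))

inArc? : ∀ x y p → Dec (InArc x y p)
inArc? x y p = (x ≤? y ×-dec x ≤? p ×-dec p <? y) ⊎-dec (y <? x ×-dec (x ≤? p ⊎-dec p <? y))

inArc : ℕ → ℕ → ℕ → Bool
inArc x y p = does (inArc? x y p)

module _ {x y p : ℕ} where

  arc-inside : x ≤ y → x ≤ p → p < y → inArc x y p ≡ true
  arc-inside x≤y x≤p p<y = dec-true (inArc? x y p) (inj₁ (x≤y , x≤p , p<y))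

  arc-below : x ≤ y → p < x → inArc x y p ≡ false
  arc-below x≤y p<x = dec-false (inArc? x y p) λ
    { (inj₁ (_ , x≤p , _)) → <⇒≱ p<x x≤p
    ; (inj₂ (y<x , _)) → <⇒≱ y<x x≤y }

  arc-above : x ≤ y → y ≤ p → inArc x y p ≡ false
  arc-above x≤y y≤p = dec-false (inArc? x y p) λ
    { (inj₁ (_ , _ , p<y)) → <⇒≱ p<y y≤p
    ; (inj₂ (y<x , _)) → <⇒≱ y<x x≤y }

  arc-wrap-high : y < x → x ≤ p → inArc x y p ≡ true
  arc-wrap-high y<x x≤p = dec-true (inArc? x y p) (inj₂ (y<x , inj₁ x≤p))

  arc-wrap-low : y < x → p < y → inArc x y p ≡ true
  arc-wrap-low y<x p<y = dec-true (inArc? x y p) (inj₂ (y<x , inj₂ p<y))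

  arc-wrap-gap : y < x → y ≤ p → p < x → inArc x y p ≡ false
  arc-wrap-gap y<x y≤p p<x = dec-false (inArc? x y p) λ
    { (inj₁ (x≤y , _)) → <⇒≱ y<x x≤y
    ; (inj₂ (_ , inj₁ x≤p)) → <⇒≱ p<x x≤p
    ; (inj₂ (_ , inj₂ p<y)) → <⇒≱ p<y y≤p }

arc-cover : ∀ x y p → x < y → InArc x y p ⊎ InArc y x p
arc-cover x y p x<y with p <? x
... | yes p<x = inj₂ (inj₂ (x<y , inj₂ p<x))
... | no p≮x with p <? y
... | yes p<y = inj₁ (inj₁ (<⇒≤ x<y , ≮⇒≥ p≮x , p<y))
... | no p≮y = inj₂ (inj₂ (x<y , inj₁ (≮⇒≥ p≮y)))

module CountingOn (m : ℕ) where
  open CycleOn m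
  open ForestsOnCycle m

  accepts : (ℕ → Constraint) → State → Configuration N → Bool
  accepts cs q x = does (run cs (labelAt x) q N ≟ˢ q)

  withAllEdges : (ℕ → Constraint) → ℕ → Constraint
  withAllEdges cs p = (proj₁ (cs p) , true)

  -- configurations with every edge chosen are accepted too, but they contain the whole cycle
  forestsWith : (ℕ → Constraint) → Configuration N → Bool
  forestsWith cs x = (accepts cs unrooted x ∧ not (accepts (withAllEdges cs) unrooted x))
                   ∨ (accepts cs rooted x ∧ not (accepts (withAllEdges cs) rooted x))

  Satisfies : (ℕ → Constraint) → Configuration N → Set
  Satisfies cs x = ∀ p → p < N → sat (cs p) (labelAt x p) ≡ true

  labelAt≡cycleLabel : ∀ x p → p < N → labelAt x p ≡ cycleLabel x p
  labelAt≡cycleLabel (S , R) p p<N = cong₂ _,_ (at≡ R) (at≡ S)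
    where
    at≡ : ∀ v → at v p ≡ lookup v (advance p zero)
    at≡ v = sym (trans (lookup≡at v (advance p zero)) (cong (at v) (toℕ-advance p p<N)))

  run-labelAt : ∀ x q → run free (labelAt x) q N ≡ run free (cycleLabel x) q N
  run-labelAt x q = run-cong free (labelAt x) (cycleLabel x) q N (labelAt≡cycleLabel x)

  accepts⇒ : ∀ cs q x → q ≢ dead → accepts cs q x ≡ true → Satisfies cs x × ReturnsTo x q
  accepts⇒ cs q x alive acc with run cs (labelAt x) q N ≟ˢ q
  ... | yes ret = sats , trans (sym (run-labelAt x q)) (trans (sym (run-free cs (labelAt x) q N sats)) ret)
    where
    sats : Satisfies cs x
    sats = run-sat cs (labelAt x) q N (λ dies → alive (trans (sym ret) dies))

  accepts⇐ : ∀ cs q x → Satisfies cs x → ReturnsTo x q → accepts cs q x ≡ true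
  accepts⇐ cs q x sats ret = dec-true (run cs (labelAt x) q N ≟ˢ q)
    (trans (run-free cs (labelAt x) q N sats) (trans (run-labelAt x q) ret))

  allEdges-no-gap : ∀ cs x → Satisfies (withAllEdges cs) x → ¬ HasGap (proj₁ x)
  allEdges-no-gap cs x@(S , R) sats (v , Sv)
    with trans (sym (sat-edge (withAllEdges cs (toℕ v)) (labelAt x (toℕ v)) (sats (toℕ v) (toℕ<n v)) refl))
               (trans (sym (lookup≡at S v)) Sv)
  ... | ()

  allEdges-weaken : ∀ cs x → Satisfies (withAllEdges cs) x → Satisfies cs x
  allEdges-weaken cs x sats p p<N = sat-intro (cs p) (labelAt x p)
    (sat-root (withAllEdges cs p) (labelAt x p) (sats p p<N)) (λ _ → sat-edge (withAllEdges cs p) (labelAt x p) (sats p p<N) refl)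

  allEdges-strengthen : ∀ cs x → Satisfies cs x → (∀ v → lookup (proj₁ x) v ≡ true) → Satisfies (withAllEdges cs) x
  allEdges-strengthen cs x@(S , R) sats all p p<N = sat-intro (withAllEdges cs p) (labelAt x p)
    (sat-root (cs p) (labelAt x p) (sats p p<N))
    (λ _ → trans (sym (cong (at S) (toℕ-fromℕ< p<N))) (trans (sym (lookup≡at S (fromℕ< p<N))) (all _)))

  private
    has-gap : ∀ cs q x → q ≢ dead → accepts cs q x ≡ true → accepts (withAllEdges cs) q x ≡ false → HasGap (proj₁ x)
    has-gap cs q x alive acc ¬acc with all-chosen⊎gap (proj₁ x)
    ... | inj₂ g = g
    ... | inj₁ all with accepts⇒ cs q x alive acc
    ... | sats , ret with trans (sym (accepts⇐ (withAllEdges cs) q x (allEdges-strengthen cs x sats all) ret)) ¬acc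
    ... | ()

    not-allEdges : ∀ cs q x → q ≢ dead → HasGap (proj₁ x) → accepts (withAllEdges cs) q x ≡ false
    not-allEdges cs q x alive g with accepts (withAllEdges cs) q x in acc
    ... | false = refl
    ... | true = ⊥-elim (allEdges-no-gap cs x (proj₁ (accepts⇒ (withAllEdges cs) q x alive acc)) g)

    from-state : ∀ cs q x → q ≢ dead → accepts cs q x ∧ not (accepts (withAllEdges cs) q x) ≡ true →
                 Satisfies cs x × HasGap (proj₁ x) × ReturnsTo x q
    from-state cs q x alive h with accepts cs q x in acc | accepts (withAllEdges cs) q x in acc′
    ... | true | false = proj₁ (accepts⇒ cs q x alive acc) , has-gap cs q x alive acc acc′ , proj₂ (accepts⇒ cs q x alive acc)

  forestsWith⇒ : ∀ cs x → forestsWith cs x ≡ true → Satisfies cs x × HasGap (proj₁ x) × ReturnsSomewhere x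
  forestsWith⇒ cs x h with accepts cs unrooted x ∧ not (accepts (withAllEdges cs) unrooted x) in from-u
  ... | true with from-state cs unrooted x (λ ()) from-u
  ...   | sats , g , ret = sats , g , inj₁ ret
  forestsWith⇒ cs x h | false with from-state cs rooted x (λ ()) h
  ...   | sats , g , ret = sats , g , inj₂ ret

  forestsWith⇐ : ∀ cs x → Satisfies cs x → HasGap (proj₁ x) → ReturnsSomewhere x → forestsWith cs x ≡ true
  forestsWith⇐ cs x sats g (inj₁ ret) rewrite accepts⇐ cs unrooted x sats ret | not-allEdges cs unrooted x (λ ()) g = refl
  forestsWith⇐ cs x sats g (inj₂ ret) rewrite accepts⇐ cs rooted x sats ret | not-allEdges cs rooted x (λ ()) g
    with accepts cs unrooted x ∧ not (accepts (withAllEdges cs) unrooted x)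
  ... | true = refl
  ... | false = refl

  count-accepts : ∀ cs q → q ≢ dead → count (accepts cs q) (configurations N) ≡ entry (transferProduct cs N) q q
  count-accepts cs q alive = count-runs cs N q q alive

  count-forestsWith : ∀ cs → count (forestsWith cs) (configurations N) + trace (transferProduct (withAllEdges cs) N)
                             ≡ trace (transferProduct cs N)
  count-forestsWith cs = begin
    count (forestsWith cs) xs + trace (transferProduct cs⁺ N)
      ≡⟨ cong₂ _+_ (count-∨ fromU fromR disjoint xs) (trace≡entries (transferProduct cs⁺ N)) ⟩
    (count fromU xs + count fromR xs) + (entry (transferProduct cs⁺ N) unrooted unrooted + entry (transferProduct cs⁺ N) rooted rooted)
      ≡⟨ cong₂ (λ u v → (count fromU xs + count fromR xs) + (u + v))
               (sym (count-accepts cs⁺ unrooted (λ ()))) (sym (count-accepts cs⁺ rooted (λ ()))) ⟩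
    (count fromU xs + count fromR xs) + (count (accepts cs⁺ unrooted) xs + count (accepts cs⁺ rooted) xs)
      ≡⟨ +-interchange (count fromU xs) (count fromR xs) _ _ ⟩
    (count fromU xs + count (accepts cs⁺ unrooted) xs) + (count fromR xs + count (accepts cs⁺ rooted) xs)
      ≡⟨ cong₂ _+_ (count-∧-not (accepts cs unrooted) (accepts cs⁺ unrooted) (weaken unrooted (λ ())) xs)
                   (count-∧-not (accepts cs rooted) (accepts cs⁺ rooted) (weaken rooted (λ ())) xs) ⟩
    count (accepts cs unrooted) xs + count (accepts cs rooted) xs
      ≡⟨ cong₂ _+_ (count-accepts cs unrooted (λ ())) (count-accepts cs rooted (λ ())) ⟩
    entry (transferProduct cs N) unrooted unrooted + entry (transferProduct cs N) rooted rooted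
      ≡⟨ sym (trace≡entries (transferProduct cs N)) ⟩
    trace (transferProduct cs N) ∎
    where
    xs = configurations N
    cs⁺ = withAllEdges cs
    fromU fromR : Configuration N → Bool
    fromU x = accepts cs unrooted x ∧ not (accepts cs⁺ unrooted x)
    fromR x = accepts cs rooted x ∧ not (accepts cs⁺ rooted x)
    weaken : ∀ q → q ≢ dead → ∀ x → accepts cs⁺ q x ≡ true → accepts cs q x ≡ true
    weaken q alive x acc with accepts⇒ cs⁺ q x alive acc
    ... | sats , ret = accepts⇐ cs q x (allEdges-weaken cs x sats) ret
    disjoint : ∀ x → fromU x ≡ true → fromR x ≡ true → ⊥
    disjoint x u r with from-state cs unrooted x (λ ()) u | from-state cs rooted x (λ ()) r
    ... | _ , g , ret-u | _ , _ , ret-r = returns-exclusive (proj₁ x) (proj₂ x) g ret-u ret-r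

  card-configurations : (P : Configuration N → Set) (p : Configuration N → Bool) →
                        (∀ x → p x ≡ true → P x) → (∀ x → P x → p x ≡ true) → Card P (count p (configurations N))
  card-configurations P p sound complete = card-count P p (configurations N) (configurations-unique N)
    (configurations-complete N) (λ x → mk⇔ (sound x) (complete x))

  edgeAt : Vec Bool N → ℕ → Bool
  edgeAt S p = lookup S (advance p zero)

  edgeAt-periodic : ∀ S p → edgeAt S (N + p) ≡ edgeAt S p
  edgeAt-periodic S p = cong (lookup S) (trans (advance-+ N p zero) (advance-N _))

  edgeAt≡at : ∀ S p → p < N → edgeAt S p ≡ at S p
  edgeAt≡at S p p<N = trans (lookup≡at S (advance p zero)) (cong (at S) (toℕ-advance p p<N))

  ArcChosen : Vec Bool N → ℕ → ℕ → Set
  ArcChosen S x y = ∀ p → p < N → InArc x y p → at S p ≡ true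

  StepsChosen : Vec Bool N → ℕ → ℕ → Set
  StepsChosen S a b = ∀ t → t < clockwise a b → edgeAt S (t + a) ≡ true

  module _ (S : Vec Bool N) {a b : ℕ} (a<N : a < N) (b<N : b < N) where

    reach⇒steps : Reach S (advance a zero) (advance b zero) → StepsChosen S a b
    reach⇒steps (k , eq , chosen) t t<cw = trans (cong (lookup S) (advance-+ t a zero)) (chosen t (<-≤-trans t<cw cw≤k))
      where
      spec = clockwise-spec a b a<N b<N
      cw≤k : clockwise a b ≤ k
      cw≤k with k <? N
      ... | yes k<N = ≤-reflexive (advance-injectiveˡ (advance a zero) (proj₁ spec) k<N (trans (proj₂ spec) (sym eq)))
      ... | no k≮N = <⇒≤ (<-≤-trans (proj₁ spec) (≮⇒≥ k≮N))

    steps⇒reach : StepsChosen S a b → Reach S (advance a zero) (advance b zero)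
    steps⇒reach chosen = clockwise a b , proj₂ (clockwise-spec a b a<N b<N) ,
      λ t t<cw → trans (cong (lookup S) (sym (advance-+ t a zero))) (chosen t t<cw)

    steps⇒arc : StepsChosen S a b → ArcChosen S a b
    steps⇒arc chosen p p<N (inj₁ (a≤b , a≤p , p<b)) =
      trans (sym (edgeAt≡at S p p<N)) (subst (λ w → edgeAt S w ≡ true) (m∸n+n≡m a≤p)
        (chosen (p ∸ a) (subst (p ∸ a <_) (sym (clockwise-≤ a≤b)) (∸-monoˡ-< p<b a≤p))))
    steps⇒arc chosen p p<N (inj₂ (b<a , inj₁ a≤p)) =
      trans (sym (edgeAt≡at S p p<N)) (subst (λ w → edgeAt S w ≡ true) (m∸n+n≡m a≤p)
        (chosen (p ∸ a) (subst (p ∸ a <_) (sym (clockwise-> b<a)) (≤-trans (∸-monoˡ-< p<N a≤p) (m≤m+n (N ∸ a) b)))))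
    steps⇒arc chosen p p<N (inj₂ (b<a , inj₂ p<b)) =
      trans (sym (edgeAt≡at S p p<N)) (trans (sym (edgeAt-periodic S p)) (subst (λ w → edgeAt S w ≡ true) around
        (chosen (N ∸ a + p) (subst (N ∸ a + p <_) (sym (clockwise-> b<a)) (+-monoʳ-< (N ∸ a) p<b)))))
      where
      around : N ∸ a + p + a ≡ N + p
      around = trans (+-assoc (N ∸ a) p a) (trans (cong (N ∸ a +_) (+-comm p a))
                 (trans (sym (+-assoc (N ∸ a) a p)) (cong (_+ p) (m∸n+n≡m (<⇒≤ a<N)))))

    arc⇒steps : ArcChosen S a b → StepsChosen S a b
    arc⇒steps chosen t t<cw with a ≤? b
    ... | yes a≤b = trans (edgeAt≡at S (t + a) t+a<N) (chosen (t + a) t+a<N (inj₁ (a≤b , m≤n+m a t , t+a<b)))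
      where
      t+a<b : t + a < b
      t+a<b = subst (t + a <_) (m∸n+n≡m a≤b) (+-monoˡ-< a t<cw)
      t+a<N = <-trans t+a<b b<N
    ... | no a≰b with t + a <? N
    ...   | yes t+a<N = trans (edgeAt≡at S (t + a) t+a<N) (chosen (t + a) t+a<N (inj₂ (≰⇒> a≰b , inj₁ (m≤n+m a t))))
    ...   | no t+a≮N = trans (cong (edgeAt S) (sym N+q≡)) (trans (edgeAt-periodic S q)
                          (trans (edgeAt≡at S q q<N) (chosen q q<N (inj₂ (≰⇒> a≰b , inj₂ q<b)))))
      where
      q = t + a ∸ N
      N+q≡ : N + q ≡ t + a
      N+q≡ = m+[n∸m]≡n (≮⇒≥ t+a≮N)
      N∸a+b+a≡ : N ∸ a + b + a ≡ N + b
      N∸a+b+a≡ = trans (+-assoc (N ∸ a) b a) (trans (cong (N ∸ a +_) (+-comm b a))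
                   (trans (sym (+-assoc (N ∸ a) a b)) (cong (_+ b) (m∸n+n≡m (<⇒≤ a<N)))))
      q<b : q < b
      q<b = +-cancelˡ-< N q b (subst (_< N + b) (sym N+q≡) (subst (t + a <_) N∸a+b+a≡
              (+-monoˡ-< a t<cw)))
      q<N = <-trans q<b b<N

  reach⇒arcChosen : ∀ S u v → Reach S u v → ArcChosen S (toℕ u) (toℕ v)
  reach⇒arcChosen S u v r = steps⇒arc S (toℕ<n u) (toℕ<n v)
    (reach⇒steps S (toℕ<n u) (toℕ<n v) (subst₂ (Reach S) (sym (advance-toℕ u)) (sym (advance-toℕ v)) r))

  arcChosen⇒reach : ∀ S u v → ArcChosen S (toℕ u) (toℕ v) → Reach S u v
  arcChosen⇒reach S u v chosen = subst₂ (Reach S) (advance-toℕ u) (advance-toℕ v)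
    (steps⇒reach S (toℕ<n u) (toℕ<n v) (arc⇒steps S (toℕ<n u) (toℕ<n v) chosen))

  rootAt : ℕ → ℕ → Constraint
  rootAt a p = (does (p ≟ a) , false)

  rootWithArc : ℕ → ℕ → ℕ → ℕ → Constraint
  rootWithArc a x y p = (does (p ≟ a) , inArc x y p)

  private
    single : ∀ (cs : ℕ → Constraint) {c} k → cs k ≡ c → ∀ p → p < 1 → cs (k + p) ≡ c
    single cs k eq zero _ = trans (cong cs (+-identityʳ k)) eq
    single cs k eq (suc p) (s<s ())

    vacuous : ∀ (cs : ℕ → Constraint) {c} k → ∀ p → p < 0 → cs (k + p) ≡ c
    vacuous _ _ _ ()

    is-root : ∀ a → does (a ≟ a) ≡ true
    is-root a = dec-true (a ≟ a) refl

    not-root : ∀ {p a} → p ≢ a → does (p ≟ a) ≡ false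
    not-root {p} {a} = dec-false (p ≟ a)

  module _ (a d : ℕ) (N≡ : N ≡ a + (0 + (1 + d))) where

    trace-rootAt-allEdges : trace (transferProduct (withAllEdges (rootAt a)) N) ≡ 0
    trace-rootAt-allEdges = begin
      trace (transferProduct cs N)
        ≡⟨ cong (λ k → trace (transferProduct cs k)) N≡ ⟩
      trace (transferProduct cs (a + (0 + (1 + d))))
        ≡⟨ cong trace (transferProduct-blocks cs a 0 1 d (false , true) (false , false) (true , true) (false , true)
             (λ p p<a → cong₂ _,_ (not-root (<⇒≢ p<a)) refl) (vacuous cs a)
             (single cs a (cong₂ _,_ (is-root a) refl))
             (λ p _ → cong₂ _,_ (not-root (m+1+n≢m a)) refl)) ⟩
      trace (Edge ^ᴹ a ⊗ (Free ^ᴹ 0 ⊗ (RootEdge ^ᴹ 1 ⊗ Edge ^ᴹ d)))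
        ≡⟨ trace-E-F-RE-E a 0 d ⟩
      0 ∎
      where cs = withAllEdges (rootAt a)

    trace-rootAt : trace (transferProduct (rootAt a) N) ≡ fib (double N)
    trace-rootAt = begin
      trace (transferProduct (rootAt a) N)
        ≡⟨ cong (λ k → trace (transferProduct (rootAt a) k)) N≡ ⟩
      trace (transferProduct (rootAt a) (a + (0 + (1 + d))))
        ≡⟨ cong trace (transferProduct-blocks (rootAt a) a 0 1 d (false , false) (false , true) (true , false) (false , false)
             (λ p p<a → cong₂ _,_ (not-root (<⇒≢ p<a)) refl) (vacuous (rootAt a) a)
             (single (rootAt a) a (cong₂ _,_ (is-root a) refl))
             (λ p _ → cong₂ _,_ (not-root (m+1+n≢m a)) refl)) ⟩
      trace (Free ^ᴹ a ⊗ (Edge ^ᴹ 0 ⊗ (Root ^ᴹ 1 ⊗ Free ^ᴹ d)))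
        ≡⟨ trace-F-E-R-F a 0 d ⟩
      fib (double (suc (d + a)))
        ≡⟨ cong (fib ∘ double) (sym (trans N≡ (trans (+-suc a d) (cong suc (+-comm a d))))) ⟩
      fib (double N) ∎

  module _ (a c d : ℕ) (N≡ : N ≡ a + (1 + (c + d))) where
    private
      b = a + suc c
      a<b : a < b
      a<b = m<m+n a z<s
      a≤b = <⇒≤ a<b
      blocks = λ cs → transferProduct-blocks cs a 1 c d

    trace-root-arc-to-larger : trace (transferProduct (rootWithArc a a b) N) ≡ fib (double (d + a))
    trace-root-arc-to-larger = begin
      trace (transferProduct cs N)
        ≡⟨ cong (λ k → trace (transferProduct cs k)) N≡ ⟩
      trace (transferProduct cs (a + (1 + (c + d))))
        ≡⟨ cong trace (blocks cs (false , false) (true , true) (false , true) (false , false)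
             (λ p p<a → cong₂ _,_ (not-root (<⇒≢ p<a)) (arc-below a≤b p<a))
             (single cs a (cong₂ _,_ (is-root a) (arc-inside a≤b ≤-refl a<b)))
             (λ p p<c → cong₂ _,_ (not-root (m+1+n≢m a)) (arc-inside a≤b (m≤m+n a (suc p)) (+-monoʳ-< a (s<s p<c))))
             (λ p _ → cong₂ _,_ (not-root (m+1+n≢m a)) (arc-above a≤b (+-monoʳ-≤ a (s≤s (m≤m+n c p)))))) ⟩
      trace (Free ^ᴹ a ⊗ (RootEdge ^ᴹ 1 ⊗ (Edge ^ᴹ c ⊗ Free ^ᴹ d)))
        ≡⟨ trace-F-RE-E-F a c d ⟩
      fib (double (d + a)) ∎
      where cs = rootWithArc a a b

    trace-root-arc-from-larger : trace (transferProduct (rootWithArc a b a) N) ≡ fib (double (suc c))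
    trace-root-arc-from-larger = begin
      trace (transferProduct cs N)
        ≡⟨ cong (λ k → trace (transferProduct cs k)) N≡ ⟩
      trace (transferProduct cs (a + (1 + (c + d))))
        ≡⟨ cong trace (blocks cs (false , true) (true , false) (false , false) (false , true)
             (λ p p<a → cong₂ _,_ (not-root (<⇒≢ p<a)) (arc-wrap-low a<b p<a))
             (single cs a (cong₂ _,_ (is-root a) (arc-wrap-gap a<b ≤-refl a<b)))
             (λ p p<c → cong₂ _,_ (not-root (m+1+n≢m a)) (arc-wrap-gap a<b (m≤m+n a (suc p)) (+-monoʳ-< a (s<s p<c))))
             (λ p _ → cong₂ _,_ (not-root (m+1+n≢m a)) (arc-wrap-high a<b (+-monoʳ-≤ a (s≤s (m≤m+n c p)))))) ⟩
      trace (Edge ^ᴹ a ⊗ (Root ^ᴹ 1 ⊗ (Free ^ᴹ c ⊗ Edge ^ᴹ d)))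
        ≡⟨ trace-E-R-F-E a c d ⟩
      fib (double (suc c)) ∎
      where cs = rootWithArc a b a

  module _ (b c d : ℕ) (0<c : 0 < c) (N≡ : N ≡ b + (c + (1 + d))) where
    private
      a = b + c
      b<a : b < a
      b<a = m<m+n b 0<c
      b≤a = <⇒≤ b<a
      blocks = λ cs → transferProduct-blocks cs b c 1 d
      a≡ : ∀ p → b + (c + suc p) ≡ a + suc p
      a≡ p = sym (+-assoc b c (suc p))

    trace-root-arc-to-smaller : trace (transferProduct (rootWithArc a a b) N) ≡ fib (double c)
    trace-root-arc-to-smaller = begin
      trace (transferProduct cs N)
        ≡⟨ cong (λ k → trace (transferProduct cs k)) N≡ ⟩
      trace (transferProduct cs (b + (c + (1 + d))))
        ≡⟨ cong trace (blocks cs (false , true) (false , false) (true , true) (false , true)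
             (λ p p<b → cong₂ _,_ (not-root (<⇒≢ (<-trans p<b b<a))) (arc-wrap-low b<a p<b))
             (λ p p<c → cong₂ _,_ (not-root (<⇒≢ (+-monoʳ-< b p<c))) (arc-wrap-gap b<a (m≤m+n b p) (+-monoʳ-< b p<c)))
             (single (cs ∘ (b +_)) c (cong₂ _,_ (is-root a) (arc-wrap-high b<a ≤-refl)))
             (λ p _ → subst (λ k → cs k ≡ (false , true)) (sym (a≡ p))
                        (cong₂ _,_ (not-root (m+1+n≢m a)) (arc-wrap-high b<a (m≤m+n a (suc p)))))) ⟩
      trace (Edge ^ᴹ b ⊗ (Free ^ᴹ c ⊗ (RootEdge ^ᴹ 1 ⊗ Edge ^ᴹ d)))
        ≡⟨ trace-E-F-RE-E b c d ⟩
      fib (double c) ∎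
      where cs = rootWithArc a a b

    trace-root-arc-from-smaller : trace (transferProduct (rootWithArc a b a) N) ≡ fib (double (suc (d + b)))
    trace-root-arc-from-smaller = begin
      trace (transferProduct cs N)
        ≡⟨ cong (λ k → trace (transferProduct cs k)) N≡ ⟩
      trace (transferProduct cs (b + (c + (1 + d))))
        ≡⟨ cong trace (blocks cs (false , false) (false , true) (true , false) (false , false)
             (λ p p<b → cong₂ _,_ (not-root (<⇒≢ (<-trans p<b b<a))) (arc-below b≤a p<b))
             (λ p p<c → cong₂ _,_ (not-root (<⇒≢ (+-monoʳ-< b p<c))) (arc-inside b≤a (m≤m+n b p) (+-monoʳ-< b p<c)))
             (single (cs ∘ (b +_)) c (cong₂ _,_ (is-root a) (arc-above b≤a ≤-refl)))
             (λ p _ → subst (λ k → cs k ≡ (false , false)) (sym (a≡ p))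
                        (cong₂ _,_ (not-root (m+1+n≢m a)) (arc-above b≤a (m≤m+n a (suc p)))))) ⟩
      trace (Free ^ᴹ b ⊗ (Edge ^ᴹ c ⊗ (Root ^ᴹ 1 ⊗ Free ^ᴹ d)))
        ≡⟨ trace-F-E-R-F b c d ⟩
      fib (double (suc (d + b))) ∎
      where cs = rootWithArc a b a

  count-forestsWith-exact : ∀ cs → trace (transferProduct (withAllEdges cs) N) ≡ 0 →
                            count (forestsWith cs) (configurations N) ≡ trace (transferProduct cs N)
  count-forestsWith-exact cs no-cycle = trans (sym (+-identityʳ _))
    (trans (cong (count (forestsWith cs) (configurations N) +_) (sym no-cycle)) (count-forestsWith cs))

  N-split : ∀ {a} → a < N → N ≡ a + (0 + (1 + (m ∸ a)))
  N-split {a} a<N = sym (trans (+-suc a (m ∸ a)) (cong suc (m+[n∸m]≡n (<⇒≤pred a<N))))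

  satisfies-rootWithArc⇒ : ∀ a x y X → a < N → Satisfies (rootWithArc a x y) X → at (proj₂ X) a ≡ true × ArcChosen (proj₁ X) x y
  satisfies-rootWithArc⇒ a x y X a<N sats =
    sat-root (rootWithArc a x y a) (labelAt X a) (sats a a<N) (is-root a) ,
    λ p p<N arc → sat-edge (rootWithArc a x y p) (labelAt X p) (sats p p<N) (dec-true (inArc? x y p) arc)

  satisfies-rootWithArc⇐ : ∀ a x y X → at (proj₂ X) a ≡ true → ArcChosen (proj₁ X) x y → Satisfies (rootWithArc a x y) X
  satisfies-rootWithArc⇐ a x y X Ra chosen p p<N = sat-intro (rootWithArc a x y p) (labelAt X p)
    (λ p≡a → subst (λ k → at (proj₂ X) k ≡ true) (sym (does-true⇒ (p ≟ a) p≡a)) Ra)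
    (λ arc → chosen p p<N (does-true⇒ (inArc? x y p) arc))

  satisfies-rootAt⇒ : ∀ a X → a < N → Satisfies (rootAt a) X → at (proj₂ X) a ≡ true
  satisfies-rootAt⇒ a X a<N sats = sat-root (rootAt a a) (labelAt X a) (sats a a<N) (is-root a)

  satisfies-rootAt⇐ : ∀ a X → at (proj₂ X) a ≡ true → Satisfies (rootAt a) X
  satisfies-rootAt⇐ a X Ra p p<N = sat-intro (rootAt a p) (labelAt X p)
    (λ p≡a → subst (λ k → at (proj₂ X) k ≡ true) (sym (does-true⇒ (p ≟ a) p≡a)) Ra) (λ ())

module ForestCounts (m : ℕ) (2≤m : 2 ≤ m) where
  open CycleOn m
  open ForestsOnCycle m
  open CountingOn m

  forestCount : ℕ
  forestCount = count (forestsWith free) (configurations N)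

  card-forests : Card (RootedForest G) forestCount
  card-forests = card-configurations (RootedForest G) (forestsWith free) sound complete
    where
    sound : ∀ x → forestsWith free x ≡ true → RootedForest G x
    sound x h with forestsWith⇒ free x h
    ... | _ , g , ret = returns⇒rootedForest (proj₁ x) (proj₂ x) g ret
    complete : ∀ x → RootedForest G x → forestsWith free x ≡ true
    complete x rf with rootedForest⇒returns (proj₁ x) (proj₂ x) 2≤m rf
    ... | g , ret = forestsWith⇐ free x (λ _ _ → refl) g ret

  forestCount+2 : forestCount + 2 ≡ lucas (double N)
  forestCount+2 = begin
    forestCount + 2
      ≡⟨ cong (forestCount +_) (sym (trans (cong trace (transferProduct-const _ N (false , true) (λ _ _ → refl))) (trace-Edge-^ N))) ⟩
    forestCount + trace (transferProduct (withAllEdges free) N)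
      ≡⟨ count-forestsWith free ⟩
    trace (transferProduct free N)
      ≡⟨ cong trace (transferProduct-const free N (false , false) (λ _ _ → refl)) ⟩
    trace (Free ^ᴹ N)
      ≡⟨ trace-Free-^ m ⟩
    lucas (double N) ∎

  module _ (i j : Fin N) where
    private
      a = toℕ i
      b = toℕ j
      a<N = toℕ<n i
      b<N = toℕ<n j

      root-i : ∀ (X : Configuration N) → at (proj₂ X) a ≡ lookup (proj₂ X) i
      root-i X = sym (lookup≡at (proj₂ X) i)

    PairCount : ℕ → Set
    PairCount fij = ∃₂ λ A B → N ≡ A + B × fij ≡ fib (double A) + fib (double B) × B ≡ ∣ b - a ∣

    module SameVertex (a≡b : a ≡ b) where
      pairs : Configuration N → Bool
      pairs = forestsWith (rootAt a)

      card-pairs : Card (RootedForestIJ G i j) (count pairs (configurations N))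
      card-pairs = card-configurations (RootedForestIJ G i j) pairs sound complete
        where
        sound : ∀ X → pairs X ≡ true → RootedForestIJ G i j X
        sound X h with forestsWith⇒ (rootAt a) X h
        ... | sats , g , ret = returns⇒rootedForest (proj₁ X) (proj₂ X) g ret ,
                               subst (Connected G (proj₁ X) i) (toℕ-injective a≡b) ε ,
                               trans (sym (root-i X)) (satisfies-rootAt⇒ a X a<N sats)
        complete : ∀ X → RootedForestIJ G i j X → pairs X ≡ true
        complete X (rf , _ , Ri) with rootedForest⇒returns (proj₁ X) (proj₂ X) 2≤m rf
        ... | g , ret = forestsWith⇐ (rootAt a) X (satisfies-rootAt⇐ a X (trans (root-i X) Ri)) g ret

      pair-count : PairCount (count pairs (configurations N))
      pair-count = N , 0 , sym (+-identityʳ N) ,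
        trans (count-forestsWith-exact (rootAt a) (trace-rootAt-allEdges a (m ∸ a) (N-split a<N)))
              (trans (trace-rootAt a (m ∸ a) (N-split a<N)) (sym (+-identityʳ _))) ,
        sym (trans (cong (∣_- a ∣) (sym a≡b)) (∣n-n∣≡0 a))

    module DistinctVertices (a≢b : a ≢ b) where
      pairs : Configuration N → Bool
      pairs X = forestsWith (rootWithArc a a b) X ∨ forestsWith (rootWithArc a b a) X

      card-pairs : Card (RootedForestIJ G i j) (count pairs (configurations N))
      card-pairs = card-configurations (RootedForestIJ G i j) pairs sound complete
        where
        sound : ∀ X → pairs X ≡ true → RootedForestIJ G i j X
        sound X h with forestsWith (rootWithArc a a b) X in forward
        ... | true with forestsWith⇒ (rootWithArc a a b) X forward
        ...   | sats , g , ret = returns⇒rootedForest (proj₁ X) (proj₂ X) g ret ,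
                  reach⇒connected (proj₁ X) i j (inj₁ (arcChosen⇒reach (proj₁ X) i j (proj₂ arc))) ,
                  trans (sym (root-i X)) (proj₁ arc)
          where arc = satisfies-rootWithArc⇒ a a b X a<N sats
        sound X h | false with forestsWith⇒ (rootWithArc a b a) X h
        ...   | sats , g , ret = returns⇒rootedForest (proj₁ X) (proj₂ X) g ret ,
                  reach⇒connected (proj₁ X) i j (inj₂ (arcChosen⇒reach (proj₁ X) j i (proj₂ arc))) ,
                  trans (sym (root-i X)) (proj₁ arc)
          where arc = satisfies-rootWithArc⇒ a b a X a<N sats
        complete : ∀ X → RootedForestIJ G i j X → pairs X ≡ true
        complete X (rf , c , Ri) with rootedForest⇒returns (proj₁ X) (proj₂ X) 2≤m rf | connected⇒reach (proj₁ X) i j c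
        ... | g , ret | inj₁ r rewrite forestsWith⇐ (rootWithArc a a b) X
                (satisfies-rootWithArc⇐ a a b X (trans (root-i X) Ri) (reach⇒arcChosen (proj₁ X) i j r)) g ret = refl
        ... | g , ret | inj₂ r rewrite forestsWith⇐ (rootWithArc a b a) X
                (satisfies-rootWithArc⇐ a b a X (trans (root-i X) Ri) (reach⇒arcChosen (proj₁ X) j i r)) g ret
                with forestsWith (rootWithArc a a b) X
        ...   | true = refl
        ...   | false = refl

      -- the two arcs between i and j cover the cycle, which would then have no missing edge
      arcs-exclusive : ∀ X → forestsWith (rootWithArc a a b) X ≡ true → forestsWith (rootWithArc a b a) X ≡ true → ⊥
      arcs-exclusive X@(S , R) h₁ h₂ with forestsWith⇒ (rootWithArc a a b) X h₁ | forestsWith⇒ (rootWithArc a b a) X h₂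
      ... | sats₁ , (v , Sv) , _ | sats₂ , _ , _ with trans (sym chosen) (trans (sym (lookup≡at S v)) Sv)
        where
        forward = proj₂ (satisfies-rootWithArc⇒ a a b X a<N sats₁)
        backward = proj₂ (satisfies-rootWithArc⇒ a b a X a<N sats₂)
        p = toℕ v
        p<N = toℕ<n v
        chosen : at S p ≡ true
        chosen with <-cmp a b
        ... | tri≈ _ a≡b _ = ⊥-elim (a≢b a≡b)
        ... | tri< a<b _ _ = [ forward p p<N , backward p p<N ]′ (arc-cover a b p a<b)
        ... | tri> _ _ b<a = [ backward p p<N , forward p p<N ]′ (arc-cover b a p b<a)
      ... | ()

      count-pairs : count pairs (configurations N)
                    ≡ trace (transferProduct (rootWithArc a a b) N) + trace (transferProduct (rootWithArc a b a) N)
      count-pairs = trans (count-∨ (forestsWith (rootWithArc a a b)) (forestsWith (rootWithArc a b a)) arcs-exclusive (configurations N))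
        (cong₂ _+_ (count-forestsWith-exact (rootWithArc a a b) (trace-rootAt-allEdges a (m ∸ a) (N-split a<N)))
                   (count-forestsWith-exact (rootWithArc a b a) (trace-rootAt-allEdges a (m ∸ a) (N-split a<N))))

      pair-count : PairCount (count pairs (configurations N))
      pair-count with <-cmp a b
      ... | tri≈ _ a≡b _ = ⊥-elim (a≢b a≡b)
      ... | tri< a<b _ _ = d + a , suc c , N≡′ , trans count-pairs (cong₂ _+_ to from) , dist
        where
        c = b ∸ suc a
        d = N ∸ b
        a+c≡b : a + suc c ≡ b
        a+c≡b = trans (+-suc a c) (m+[n∸m]≡n a<b)
        N≡ : N ≡ a + (1 + (c + d))
        N≡ = sym (trans (sym (+-assoc a (suc c) d)) (trans (cong (_+ d) a+c≡b) (m+[n∸m]≡n (<⇒≤ b<N))))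
        N≡′ : N ≡ d + a + suc c
        N≡′ = trans N≡ (trans (sym (+-assoc a (suc c) d)) (trans (+-comm (a + suc c) d) (sym (+-assoc d a (suc c)))))
        to : trace (transferProduct (rootWithArc a a b) N) ≡ fib (double (d + a))
        to = subst (λ w → trace (transferProduct (rootWithArc a a w) N) ≡ fib (double (d + a))) a+c≡b
                   (trace-root-arc-to-larger a c d N≡)
        from : trace (transferProduct (rootWithArc a b a) N) ≡ fib (double (suc c))
        from = subst (λ w → trace (transferProduct (rootWithArc a w a) N) ≡ fib (double (suc c))) a+c≡b
                     (trace-root-arc-from-larger a c d N≡)
        dist : suc c ≡ ∣ b - a ∣
        dist = sym (trans (cong (∣_- a ∣) (sym a+c≡b)) (trans (∣-∣-comm (a + suc c) a) (∣m-m+n∣≡n a (suc c))))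
      ... | tri> _ _ b<a = suc (d + b) , c , N≡′ ,
                           trans count-pairs (trans (cong₂ _+_ to from) (+-comm (fib (double c)) _)) , dist
        where
        c = a ∸ b
        d = m ∸ a
        b+c≡a : b + c ≡ a
        b+c≡a = m+[n∸m]≡n (<⇒≤ b<a)
        N≡ : N ≡ b + (c + (1 + d))
        N≡ = sym (trans (sym (+-assoc b c (suc d))) (trans (cong (_+ suc d) b+c≡a)
                   (trans (+-suc a d) (cong suc (m+[n∸m]≡n (<⇒≤pred a<N))))))
        N≡′ : N ≡ suc (d + b) + c
        N≡′ = trans N≡ (rearrange b c d)
          where
          rearrange : ∀ b c d → b + (c + (1 + d)) ≡ 1 + (d + b) + c
          rearrange = solve-∀
        to : trace (transferProduct (rootWithArc a a b) N) ≡ fib (double c)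
        to = subst (λ w → trace (transferProduct (rootWithArc w w b) N) ≡ fib (double c)) b+c≡a
                   (trace-root-arc-to-smaller b c d (m<n⇒0<n∸m b<a) N≡)
        from : trace (transferProduct (rootWithArc a b a) N) ≡ fib (double (suc (d + b)))
        from = subst (λ w → trace (transferProduct (rootWithArc w b w) N) ≡ fib (double (suc (d + b)))) b+c≡a
                     (trace-root-arc-from-smaller b c d (m<n⇒0<n∸m b<a) N≡)
        dist : c ≡ ∣ b - a ∣
        dist = sym (trans (cong (∣ b -_∣) (sym b+c≡a)) (∣m-m+n∣≡n b c))

    pair-forests : ∃ λ fij → Card (RootedForestIJ G i j) fij × PairCount fij
    pair-forests with a ≟ b
    ... | yes a≡b = _ , SameVertex.card-pairs a≡b , SameVertex.pair-count a≡b
    ... | no a≢b = _ , DistinctVertices.card-pairs a≢b , DistinctVertices.pair-count a≢b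

min-distance-split : ∀ A B → ∃₂ λ c t → A + B ≡ double c + t ×
  fib (double A) + fib (double B) ≡ fib (double c + double t) + fib (double c) × ∣ A + B - 2 * B ∣ ≡ t
min-distance-split A B with ≤-total B A
... | inj₁ B≤A = B , t , A+B≡ , cong (λ k → fib k + fib (double B)) 2A≡ , dist≡
  where
  t = A ∸ B
  A≡ : A ≡ B + t
  A≡ = sym (m+[n∸m]≡n B≤A)
  A+B≡ : A + B ≡ double B + t
  A+B≡ = trans (cong (_+ B) A≡) (trans (+-comm (B + t) B) (trans (sym (+-assoc B B t)) (cong (_+ t) (sym (double≡+ B)))))
  2A≡ : double A ≡ double B + double t
  2A≡ = trans (cong double A≡) (double-+ B t)
  dist≡ : ∣ A + B - 2 * B ∣ ≡ t
  dist≡ = begin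
    ∣ A + B - 2 * B ∣     ≡⟨ cong (λ k → ∣ k - 2 * B ∣) (trans A+B≡ (cong (_+ t) (double≡2* B))) ⟩
    ∣ 2 * B + t - 2 * B ∣ ≡⟨ ∣-∣-comm (2 * B + t) (2 * B) ⟩
    ∣ 2 * B - 2 * B + t ∣ ≡⟨ ∣m-m+n∣≡n (2 * B) t ⟩
    t                     ∎
... | inj₂ A≤B = A , t , A+B≡ , trans (+-comm (fib (double A)) (fib (double B))) (cong (λ k → fib k + fib (double A)) 2B≡) , dist≡
  where
  t = B ∸ A
  B≡ : B ≡ A + t
  B≡ = sym (m+[n∸m]≡n A≤B)
  A+B≡ : A + B ≡ double A + t
  A+B≡ = trans (cong (A +_) B≡) (trans (sym (+-assoc A A t)) (cong (_+ t) (sym (double≡+ A))))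
  2B≡ : double B ≡ double A + double t
  2B≡ = trans (cong double B≡) (double-+ A t)
  dist≡ : ∣ A + B - 2 * B ∣ ≡ t
  dist≡ = begin
    ∣ A + B - 2 * B ∣               ≡⟨ cong₂ ∣_-_∣ (trans A+B≡ (cong (_+ t) (double≡2* A)))
                                         (trans (sym (double≡2* B)) (trans 2B≡ (cong₂ _+_ (double≡2* A) (double≡+ t)))) ⟩
    ∣ 2 * A + t - 2 * A + (t + t) ∣ ≡⟨ ∣m+n-m+o∣≡∣n-o∣ (2 * A) t (t + t) ⟩
    ∣ t - t + t ∣                   ≡⟨ ∣m-m+n∣≡n t t ⟩
    t                               ∎

forest-ratio-odd : ∀ {n A B f fij} → n ≡ A + B → n % 2 ≡ 1 →
  fij ≡ fib (double A) + fib (double B) → f + 2 ≡ lucas (double n) →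
  fij * lucas n ≡ f * fib ∣ n - 2 * B ∣
forest-ratio-odd {A = A} {B} {f} {fij} refl odd fij≡ f≡ with min-distance-split A B
... | c , t , n≡ , sum≡ , dist≡ with odd-part c t (trans (cong (_% 2) (sym n≡)) odd)
... | u , refl = begin
  fij * L      ≡⟨ cong (_* L) fij≡L*F ⟩
  L * F * L    ≡⟨ rearrange L F ⟩
  L * L * F    ≡⟨ cong (_* F) (sym f≡L*L) ⟩
  f * F        ≡⟨ cong (λ k → f * fib k) (sym dist≡) ⟩
  f * fib ∣ A + B - 2 * B ∣ ∎
  where
  L = lucas (A + B)
  F = fib t
  n≡odd : A + B ≡ suc (double (c + u))
  n≡odd = trans n≡ (trans (+-suc (double c) (double u)) (cong suc (sym (double-+ c u))))
  fij≡L*F : fij ≡ L * F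
  fij≡L*F = trans fij≡ (trans sum≡ (trans (fib-sum-odd (double c) u) (cong (λ k → lucas k * F) (sym n≡))))
  f≡L*L : f ≡ L * L
  f≡L*L = +-cancelʳ-≡ 2 f (L * L) (trans f≡ (subst (λ k → lucas (double k) ≡ lucas k * lucas k + 2)
                                                     (sym n≡odd) (lucas-double-odd (c + u))))
  rearrange : ∀ l x → l * x * l ≡ l * l * x
  rearrange = solve-∀

forest-ratio-even : ∀ {n A B f fij} → n ≡ A + B → n % 2 ≡ 0 →
  fij ≡ fib (double A) + fib (double B) → f + 2 ≡ lucas (double n) →
  fij * (5 * fib n) ≡ f * lucas ∣ n - 2 * B ∣
forest-ratio-even {A = A} {B} {f} {fij} refl even fij≡ f≡ with min-distance-split A B
... | c , t , n≡ , sum≡ , dist≡ with even-part c t (trans (cong (_% 2) (sym n≡)) even)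
... | u , refl = begin
  fij * (5 * F)        ≡⟨ cong (_* (5 * F)) fij≡F*L ⟩
  F * L * (5 * F)      ≡⟨ rearrange F L ⟩
  5 * (F * F) * L      ≡⟨ cong (_* L) (sym f≡5F²) ⟩
  f * L                ≡⟨ cong (λ k → f * lucas k) (sym dist≡) ⟩
  f * lucas ∣ A + B - 2 * B ∣ ∎
  where
  F = fib (A + B)
  L = lucas t
  n≡even : A + B ≡ double (c + u)
  n≡even = trans n≡ (sym (double-+ c u))
  fij≡F*L : fij ≡ F * L
  fij≡F*L = trans fij≡ (trans sum≡ (trans (fib-sum-even (double c) u) (cong (λ k → fib k * L) (sym n≡))))
  f≡5F² : f ≡ 5 * (F * F)
  f≡5F² = +-cancelʳ-≡ 2 f (5 * (F * F)) (trans f≡ (subst (λ k → lucas (double k) ≡ 5 * (fib k * fib k) + 2)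
                                                         (sym n≡even) (lucas-double-even (c + u))))
  rearrange : ∀ x l → x * l * (5 * x) ≡ 5 * (x * x) * l
  rearrange = solve-∀

corollary2 : (n : ℕ) → 3 ≤ n → (i j : Fin n) →
    ∃ λ f → ∃ λ fij →
      Card (RootedForest (cycleGraph n)) f ×
      Card (RootedForestIJ (cycleGraph n) i j) fij ×
      (n % 2 ≡ 1 → fij * lucas n ≡ f * fib ∣ n - 2 * ∣ toℕ j - toℕ i ∣ ∣) ×
      (n % 2 ≡ 0 → fij * (5 * fib n) ≡ f * lucas ∣ n - 2 * ∣ toℕ j - toℕ i ∣ ∣)
corollary2 (suc m) (s≤s 2≤m) i j with ForestCounts.pair-forests m 2≤m i j
... | fij , card-ij , A , _ , n≡ , fij≡ , refl =
  forestCount , fij , card-forests , card-ij ,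
  (λ odd → forest-ratio-odd {A = A} {B = ∣ toℕ j - toℕ i ∣} n≡ odd fij≡ forestCount+2) ,
  (λ even → forest-ratio-even {A = A} {B = ∣ toℕ j - toℕ i ∣} n≡ even fij≡ forestCount+2)
  where open ForestCounts m 2≤m
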